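{- Let $\mathcal B$ be the set of partitions $\lambda$ in which every part occurs at most twice, whose alternating sum type (modulus $3$) satisfies $\Sigma_2(\lambda)=2$, and in which exactly one basic unit $(\lambda_{3i-2},\lambda_{3i-1},\lambda_{3i})$ satisfies $\lambda_{3i-1}-\lambda_{3i}=2$ (all other basic units then satisfy $\lambda_{3i-1}=\lambda_{3i}$). Put $$F_n=\frac{z^{n+1}q^{3n^2+7n+4}}{(zq;q^3)_{n+1}(q^3;q^3)_{n+1}},\qquad G_n=\frac{z^{n+1}q^{3n^2+4n+1}}{(zq;q^3)_{n+1}(q^3;q^3)_{n}},$$ and for $N\ge1$ let $B_N=\sum z^{\Sigma_1(\lambda)}q^{|\lambda|}$, summed over $\lambda\in\mathcal B$ with exactly $N$ positive parts. Then for all $n\ge0$, $$B_{3n+3}=F_n\,\frac{n}{z}+F_n\,\frac{q^{3n+3}}{z},\qquad B_{3n+2}=G_n\,\frac{q^{3n+3}}{z},$$ and for all $n\ge1$, $B_{3n+1}=G_n\,\frac{n}{z}$.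
   Context: For a partition $\lambda_1\ge\dots\ge\lambda_r>0$, append zero parts so that its length becomes a multiple $3k$ of $3$. Its basic units are the blocks $(\lambda_{3i-2},\lambda_{3i-1},\lambda_{3i})$, $1\le i\le k$, and its alternating sum type (modulus 3) is $(\Sigma_1,\Sigma_2)$ with $\Sigma_1=\sum_{i=1}^k(\lambda_{3i-2}-\lambda_{3i-1})$ and $\Sigma_2=\sum_{i=1}^k(\lambda_{3i-1}-\lambda_{3i})$. $|\lambda|$ is the sum of the parts. $(a;q)_n=\prod_{i=0}^{n-1}(1-aq^i)$, with $(a;q)_0=1$. -}

module Defs where

open import Data.Bool using (Bool; true; false; _∧_; if_then_else_)
open import Data.Nat using (ℕ; zero; suc; _+_; _*_; _∸_; _≡ᵇ_; _≤ᵇ_; _^_)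
open import Data.Nat.DivMod using (_%_; _/_)
open import Data.Integer using (ℤ; +_; -_) renaming (_+_ to _+ℤ_; _*_ to _*ℤ_)
open import Data.List using (List; []; _∷_; map; concatMap; length; filter; upTo)
open import Data.Nat.ListAction using (sum)
open import Data.Product using (_×_; _,_)
open import Relation.Binary.PropositionalEquality using (_≡_)
open import Relation.Nullary.Decidable using (yes; no)
open import Data.Bool using (T)
open import Data.Bool.Properties using (T?)

-- Partitions, represented as lists of parts (weakly decreasing, positive)

allB : {A : Set} → (A → Bool) → List A → Bool
allB p []      = true
allB p (x ∷ r) = p x ∧ allB p r

lists : ℕ → ℕ → List (List ℕ)
lists zero    b = [] ∷ []
lists (suc N) b = concatMap (λ x → map (x ∷_) (lists N b)) (upTo (suc b))

weaklyDecreasing : List ℕ → Bool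
weaklyDecreasing (a ∷ b ∷ r) = (b ≤ᵇ a) ∧ weaklyDecreasing (b ∷ r)
weaklyDecreasing _           = true

allPositive : List ℕ → Bool
allPositive = allB (λ x → 1 ≤ᵇ x)

count : ℕ → List ℕ → ℕ
count x []      = 0
count x (y ∷ r) = (if x ≡ᵇ y then 1 else 0) + count x r

atMostTwice : List ℕ → Bool
atMostTwice l = allB (λ x → count x l ≤ᵇ 2) l

units : List ℕ → List (ℕ × ℕ × ℕ)
units (a ∷ b ∷ c ∷ r) = (a , b , c) ∷ units r
units (a ∷ b ∷ [])    = (a , b , 0) ∷ []
units (a ∷ [])        = (a , 0 , 0) ∷ []
units []              = []

-- alternating sum type (modulus 3); for partitions the truncated
-- subtraction is the ordinary one
Σ₁ : List ℕ → ℕ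
Σ₁ l = sum (map (λ { (a , b , c) → a ∸ b }) (units l))

Σ₂ : List ℕ → ℕ
Σ₂ l = sum (map (λ { (a , b , c) → b ∸ c }) (units l))

unitsWithGap2 : List ℕ → ℕ
unitsWithGap2 l = length (filter (λ { (a , b , c) → T? ((b ∸ c) ≡ᵇ 2) }) (units l))

inB : List ℕ → Bool
inB l = atMostTwice l ∧ (Σ₂ l ≡ᵇ 2) ∧ (unitsWithGap2 l ≡ᵇ 1)

-- Formal power series in z and q with integer coefficients.
-- f j m is the coefficient of z^j q^m.

Series : Set
Series = ℕ → ℕ → ℤ

_≈_ : Series → Series → Set
f ≈ g = ∀ j m → f j m ≡ g j m

sum≤ : ℕ → (ℕ → ℤ) → ℤ
sum≤ zero    f = f 0
sum≤ (suc n) f = sum≤ n f +ℤ f (suc n)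

_⊕_ : Series → Series → Series
(f ⊕ g) j m = f j m +ℤ g j m

_⊛_ : Series → Series → Series
(f ⊛ g) j m = sum≤ j (λ a → sum≤ m (λ b → f a b *ℤ g (j ∸ a) (m ∸ b)))

mono : ℤ → ℕ → ℕ → Series
mono c a b j m = if (j ≡ᵇ a) ∧ (m ≡ᵇ b) then c else + 0

one : Series
one = mono (+ 1) 0 0

prod< : ℕ → (ℕ → Series) → Series
prod< zero    f = one
prod< (suc n) f = prod< n f ⊛ f n

-- 1 / (1 - z^a q^(suc b)) = Σ_k z^(a k) q^((suc b) k)
geomInv : ℕ → ℕ → Series
geomInv a b j m =
  if (m % suc b ≡ᵇ 0) ∧ (j ≡ᵇ a * (m / suc b)) then + 1 else + 0

-- division by z (shift of the z-exponent; exact on series whose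
-- z-free part vanishes)
divZ : Series → Series
divZ f j m = f (suc j) m

invZQ : ℕ → Series
invZQ n = prod< n (λ i → geomInv 1 (3 * i))          -- 1/(1 - z q^(3i+1))

invQ3 : ℕ → Series
invQ3 n = prod< n (λ i → geomInv 0 (3 * i + 2))      -- 1/(1 - q^(3i+3))

F : ℕ → Series
F n = mono (+ 1) (suc n) (3 * n ^ 2 + 7 * n + 4) ⊛ (invZQ (suc n) ⊛ invQ3 (suc n))

G : ℕ → Series
G n = mono (+ 1) (suc n) (3 * n ^ 2 + 4 * n + 1) ⊛ (invZQ (suc n) ⊛ invQ3 n)

isBN : ℕ → ℕ → ℕ → List ℕ → Bool
isBN N j m l = (length l ≡ᵇ N) ∧ weaklyDecreasing l ∧ allPositive l
             ∧ (sum l ≡ᵇ m) ∧ (Σ₁ l ≡ᵇ j) ∧ inB l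

B : ℕ → Series
B N j m = + length (filter (λ l → T? (isBN N j m l)) (lists N m))

-- Write a partition with N parts through its differences δᵢ = λᵢ − λᵢ₊₁ (λ_{N+1} = 0).
-- Then |λ| = Σ i δᵢ, Σ₁ and Σ₂ are the sums of the δᵢ with i ≡ 1 and i ≡ 2 (mod 3),
-- "each part at most twice" says that no two consecutive differences among δ₁ … δ_{N−1}
-- vanish, and positivity says δ_N ≥ 1. For λ ∈ 𝓑 the middle entries of the units are 0
-- except one which is 2; zeros cannot be adjacent, so every unit reads (d + 1, 0, e + 1)
-- except a single special unit (d, 2, e). Hence a partition in 𝓑 is a list of pairs
-- (d, e) of free naturals, the position of the special unit and (when N ≢ 0 mod 3) a
-- short tail, and its weight factorises into the geometric series 1/(1 − z q^(3i+1))
-- and 1/(1 − q^(3i+3)) of F_n and G_n. The special unit accounts for the factor n (its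
-- position) or, when it is the last unit, for the extra q^(3n+3) coming from δ_N ≥ 1.
-- Each identity is proved coefficientwise by a weight-preserving bijection between
-- the enumerated partitions and an enumeration of the monomials of the product.

module Submission where

open import Defs
open import Data.Bool using (Bool; true; false; _∧_; if_then_else_; T; not)
open import Data.Bool.Properties using (T?; T-∧)
open import Data.Empty using (⊥; ⊥-elim)
open import Data.Fin using (Fin; toℕ; fromℕ<)
open import Data.Fin.Properties using (toℕ<n; fromℕ<-toℕ; toℕ-fromℕ<)
open import Data.Integer using (+_) renaming (_+_ to _+ℤ_; _*_ to _*ℤ_)
open import Data.Integer.Properties using (pos-*)
open import Data.List
  using (List; []; _∷_; map; length; _++_; cartesianProduct; concatMap; upTo; filter; allFin; reverse; _∷ʳ_)
open import Data.List.Membership.Propositional using (_∈_)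
open import Data.List.Membership.Propositional.Properties
  using ( ∈-map⁺; ∈-map⁻; ∈-++⁺ˡ; ∈-++⁺ʳ; ∈-++⁻; ∈-cartesianProduct⁺; ∈-cartesianProduct⁻; ∈-allFin; ∈-upTo⁺
        ; ∈-concatMap⁺; ∈-concatMap⁻; ∈-filter⁺; ∈-filter⁻)
open import Data.List.Membership.Propositional.Properties.WithK using (unique∧set⇒bag)
open import Data.List.Properties
  using (length-map; length-++; length-tabulate; ∷-injective; reverse-involutive; length-reverse; unfold-reverse; reverse-++)
open import Data.List.Relation.Binary.BagAndSetEquality using (∼bag⇒↭)
open import Data.List.Relation.Binary.Permutation.Propositional.Properties using (↭-length)
open import Data.List.Relation.Unary.All as All using (All; []; _∷_)
open import Data.List.Relation.Unary.AllPairs using ([]; _∷_)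
open import Data.List.Relation.Unary.Any as Any using (Any; here; there)
open import Data.List.Relation.Unary.Unique.Propositional using (Unique)
import Data.List.Relation.Unary.Unique.Propositional.Properties as Unique
open import Data.Nat using (ℕ; zero; suc; _+_; _*_; _∸_; _^_; _≡ᵇ_; _≤ᵇ_; _≤_; _<_; _≥_; z≤n; s≤s)
open import Data.Nat.DivMod using (_%_; _/_; m≡m%n+[m/n]*n; m*n%n≡0; m*n/n≡m)
open import Data.Nat.ListAction using (sum)
open import Data.Nat.Properties
open import Data.Nat.Tactic.RingSolver using (solve-∀)
open import Data.Product using (_×_; _,_; proj₁; proj₂; Σ)
open import Data.Sum using (_⊎_; inj₁; inj₂)
open import Data.Unit using (tt)
open import Function.Bundles using (mk⇔; Equivalence)
open import Relation.Binary.PropositionalEquality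
open import Relation.Nullary using (Dec; yes; no)

∧-elim : ∀ {x y} → T (x ∧ y) → T x × T y
∧-elim = Equivalence.to T-∧

∧-intro : ∀ {x y} → T x → T y → T (x ∧ y)
∧-intro p q = Equivalence.from T-∧ (p , q)

length≡-of-inverses : {A B : Set} (xs : List A) (ys : List B) → Unique xs → Unique ys →
  (f : A → B) (g : B → A) → (∀ x → g (f x) ≡ x) →
  (∀ {x} → x ∈ xs → f x ∈ ys) → (∀ {y} → y ∈ ys → g y ∈ xs) → (∀ {y} → y ∈ ys → f (g y) ≡ y) →
  length xs ≡ length ys
length≡-of-inverses xs ys uxs uys f g gf f∈ g∈ fg =
  trans (sym (length-map f xs))
    (↭-length (∼bag⇒↭ (unique∧set⇒bag
      (Unique.map⁺ (λ e → trans (sym (gf _)) (trans (cong g e) (gf _))) uxs) uys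
      (mk⇔ map⊆ys ys⊆map))))
  where
  map⊆ys : ∀ {y} → y ∈ map f xs → y ∈ ys
  map⊆ys y∈ with ∈-map⁻ f y∈
  ... | x , x∈ , refl = f∈ x∈
  ys⊆map : ∀ {y} → y ∈ ys → y ∈ map f xs
  ys⊆map {y} y∈ = subst (_∈ map f xs) (fg y∈) (∈-map⁺ f (g∈ y∈))

record Model (s : Series) : Set₁ where
  field
    Obj : Set
    weight : Obj → ℕ × ℕ
    enum : ℕ → ℕ → List Obj
    enum-unique : ∀ j m → Unique (enum j m)
    enum-sound : ∀ {j m x} → x ∈ enum j m → weight x ≡ (j , m)
    enum-complete : ∀ {j m} x → weight x ≡ (j , m) → x ∈ enum j m
    coefficient : ∀ j m → s j m ≡ + length (enum j m)

concat≤ : {X : Set} → ℕ → (ℕ → List X) → List X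
concat≤ zero h = h 0
concat≤ (suc n) h = concat≤ n h ++ h (suc n)

sumℕ≤ : ℕ → (ℕ → ℕ) → ℕ
sumℕ≤ zero h = h 0
sumℕ≤ (suc n) h = sumℕ≤ n h + h (suc n)

length-concat≤ : {X : Set} (n : ℕ) (h : ℕ → List X) → length (concat≤ n h) ≡ sumℕ≤ n (λ i → length (h i))
length-concat≤ zero h = refl
length-concat≤ (suc n) h = trans (length-++ (concat≤ n h)) (cong (_+ length (h (suc n))) (length-concat≤ n h))

sum≤-+ : (n : ℕ) (h : ℕ → ℕ) → sum≤ n (λ i → + h i) ≡ + sumℕ≤ n h
sum≤-+ zero h = refl
sum≤-+ (suc n) h rewrite sum≤-+ n h = refl

sum≤-cong : (n : ℕ) {f g : ℕ → _} → (∀ i → f i ≡ g i) → sum≤ n f ≡ sum≤ n g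
sum≤-cong zero e = e 0
sum≤-cong (suc n) e = cong₂ _+ℤ_ (sum≤-cong n e) (e (suc n))

∈-concat≤⁻ : {X : Set} (n : ℕ) (h : ℕ → List X) {x : X} → x ∈ concat≤ n h → Σ ℕ (λ i → i ≤ n × x ∈ h i)
∈-concat≤⁻ zero h x∈ = 0 , z≤n , x∈
∈-concat≤⁻ (suc n) h x∈ with ∈-++⁻ (concat≤ n h) x∈
... | inj₁ x∈′ = let (i , i≤n , x∈hi) = ∈-concat≤⁻ n h x∈′ in i , m≤n⇒m≤1+n i≤n , x∈hi
... | inj₂ x∈′ = suc n , ≤-refl , x∈′

∈-concat≤⁺ : {X : Set} (n : ℕ) (h : ℕ → List X) {x : X} (i : ℕ) → i ≤ n → x ∈ h i → x ∈ concat≤ n h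
∈-concat≤⁺ zero h .zero z≤n x∈ = x∈
∈-concat≤⁺ (suc n) h i i≤ x∈ with m≤n⇒m<n∨m≡n i≤
... | inj₁ (s≤s i≤n) = ∈-++⁺ˡ (∈-concat≤⁺ n h i i≤n x∈)
... | inj₂ refl = ∈-++⁺ʳ (concat≤ n h) x∈

concat≤-unique : {X : Set} (n : ℕ) (h : ℕ → List X) (key : X → ℕ) →
  (∀ i → Unique (h i)) → (∀ i {x} → x ∈ h i → key x ≡ i) → Unique (concat≤ n h)
concat≤-unique zero h key u k = u 0
concat≤-unique (suc n) h key u k = Unique.++⁺ (concat≤-unique n h key u k) (u (suc n)) disjoint
  where
  disjoint : ∀ {v} → v ∈ concat≤ n h × v ∈ h (suc n) → ⊥
  disjoint (v∈ , v∈′) with ∈-concat≤⁻ n h v∈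
  ... | i , i≤n , v∈hi = <-irrefl refl (subst (_≤ n) (trans (sym (k i v∈hi)) (k (suc n) v∈′)) i≤n)

mono-model : (c a b : ℕ) → Model (mono (+ c) a b)
mono-model c a b = record
  { Obj = Fin c ; weight = λ _ → (a , b)
  ; enum = enum ; enum-unique = enum-unique ; enum-sound = enum-sound ; enum-complete = enum-complete ; coefficient = coefficient }
  where
  enum : ℕ → ℕ → List (Fin c)
  enum j m = if (j ≡ᵇ a) ∧ (m ≡ᵇ b) then allFin c else []
  enum-unique : ∀ j m → Unique (enum j m)
  enum-unique j m with (j ≡ᵇ a) ∧ (m ≡ᵇ b)
  ... | true = Unique.allFin⁺ c
  ... | false = []
  enum-sound : ∀ {j m x} → x ∈ enum j m → (a , b) ≡ (j , m)
  enum-sound {j} {m} x∈ with (j ≡ᵇ a) ∧ (m ≡ᵇ b) in eq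
  ... | true = let (j≡a , m≡b) = ∧-elim (subst T (sym eq) tt) in cong₂ _,_ (sym (≡ᵇ⇒≡ j a j≡a)) (sym (≡ᵇ⇒≡ m b m≡b))
  enum-sound {j} {m} () | false
  enum-complete : ∀ {j m} x → (a , b) ≡ (j , m) → x ∈ enum j m
  enum-complete {j} {m} x refl with (j ≡ᵇ j) ∧ (m ≡ᵇ m) in eq
  ... | true = ∈-allFin x
  ... | false = ⊥-elim (subst T eq (∧-intro (≡⇒≡ᵇ j j refl) (≡⇒≡ᵇ m m refl)))
  coefficient : ∀ j m → mono (+ c) a b j m ≡ + length (enum j m)
  coefficient j m with (j ≡ᵇ a) ∧ (m ≡ᵇ b)
  ... | true = cong +_ (sym (length-tabulate {n = c} (λ i → i)))
  ... | false = refl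

geomInv-model : (a b : ℕ) → Model (geomInv a b)
geomInv-model a b = record
  { Obj = ℕ ; weight = λ k → (a * k , k * suc b)
  ; enum = enum ; enum-unique = enum-unique ; enum-sound = enum-sound ; enum-complete = enum-complete ; coefficient = coefficient }
  where
  enum : ℕ → ℕ → List ℕ
  enum j m = if (m % suc b ≡ᵇ 0) ∧ (j ≡ᵇ a * (m / suc b)) then (m / suc b) ∷ [] else []
  enum-unique : ∀ j m → Unique (enum j m)
  enum-unique j m with (m % suc b ≡ᵇ 0) ∧ (j ≡ᵇ a * (m / suc b))
  ... | true = [] ∷ []
  ... | false = []
  enum-sound : ∀ {j m x} → x ∈ enum j m → (a * x , x * suc b) ≡ (j , m)
  enum-sound {j} {m} x∈ with (m % suc b ≡ᵇ 0) ∧ (j ≡ᵇ a * (m / suc b)) in eq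
  enum-sound {j} {m} (here refl) | true =
    let (divides , j≡) = ∧-elim (subst T (sym eq) tt) in
    cong₂ _,_ (sym (≡ᵇ⇒≡ j _ j≡))
      (sym (trans (m≡m%n+[m/n]*n m (suc b)) (cong (_+ (m / suc b) * suc b) (≡ᵇ⇒≡ _ 0 divides))))
  enum-sound {j} {m} () | false
  enum-complete : ∀ {j m} x → (a * x , x * suc b) ≡ (j , m) → x ∈ enum j m
  enum-complete {j} {m} x refl with ((x * suc b) % suc b ≡ᵇ 0) ∧ (a * x ≡ᵇ a * ((x * suc b) / suc b)) in eq
  ... | true = here (sym (m*n/n≡m x (suc b)))
  ... | false = ⊥-elim (subst T eq (∧-intro (≡⇒≡ᵇ _ 0 (m*n%n≡0 x (suc b)))
                   (≡⇒≡ᵇ _ _ (cong (a *_) (sym (m*n/n≡m x (suc b)))))))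
  coefficient : ∀ j m → geomInv a b j m ≡ + length (enum j m)
  coefficient j m with (m % suc b ≡ᵇ 0) ∧ (j ≡ᵇ a * (m / suc b))
  ... | true = refl
  ... | false = refl

length-cartesianProduct : {X Y : Set} (xs : List X) (ys : List Y) →
  length (cartesianProduct xs ys) ≡ length xs * length ys
length-cartesianProduct [] ys = refl
length-cartesianProduct (x ∷ xs) ys = trans (length-++ (map (x ,_) ys))
  (cong₂ _+_ (length-map (x ,_) ys) (length-cartesianProduct xs ys))

⊛-model : ∀ {f g} → Model f → Model g → Model (f ⊛ g)
⊛-model {f} {g} M₁ M₂ = record
  { Obj = M₁.Obj × M₂.Obj ; weight = weight
  ; enum = enum ; enum-unique = enum-unique ; enum-sound = enum-sound ; enum-complete = enum-complete ; coefficient = coefficient }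
  where
  module M₁ = Model M₁
  module M₂ = Model M₂
  weight : M₁.Obj × M₂.Obj → ℕ × ℕ
  weight (x , y) = (proj₁ (M₁.weight x) + proj₁ (M₂.weight y) , proj₂ (M₁.weight x) + proj₂ (M₂.weight y))
  pairs : ℕ → ℕ → ℕ → ℕ → List (M₁.Obj × M₂.Obj)
  pairs j m a b = cartesianProduct (M₁.enum a b) (M₂.enum (j ∸ a) (m ∸ b))
  enum : ℕ → ℕ → List (M₁.Obj × M₂.Obj)
  enum j m = concat≤ j (λ a → concat≤ m (λ b → pairs j m a b))
  ∈-pairs⁻ : ∀ {j m a b x y} → (x , y) ∈ pairs j m a b → x ∈ M₁.enum a b × y ∈ M₂.enum (j ∸ a) (m ∸ b)
  ∈-pairs⁻ {j} {m} {a} {b} xy∈ = ∈-cartesianProduct⁻ (M₁.enum a b) (M₂.enum (j ∸ a) (m ∸ b)) xy∈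
  enum-unique : ∀ j m → Unique (enum j m)
  enum-unique j m = concat≤-unique j _ (λ p → proj₁ (M₁.weight (proj₁ p)))
    (λ a → concat≤-unique m _ (λ p → proj₂ (M₁.weight (proj₁ p)))
       (λ b → Unique.cartesianProduct⁺ (M₁.enum-unique a b) (M₂.enum-unique _ _))
       (λ b {p} p∈ → cong proj₂ (M₁.enum-sound (proj₁ (∈-pairs⁻ {x = proj₁ p} p∈)))))
    (λ a {p} p∈ → let (_ , _ , p∈′) = ∈-concat≤⁻ m _ p∈ in
                  cong proj₁ (M₁.enum-sound (proj₁ (∈-pairs⁻ {x = proj₁ p} p∈′))))
  enum-sound : ∀ {j m p} → p ∈ enum j m → weight p ≡ (j , m)
  enum-sound {j} {m} {x , y} p∈ with ∈-concat≤⁻ j _ p∈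
  ... | a , a≤j , p∈′ with ∈-concat≤⁻ m _ p∈′
  ... | b , b≤m , p∈″ with ∈-pairs⁻ {j} {m} {a} {b} p∈″
  ... | x∈ , y∈ rewrite M₁.enum-sound x∈ | M₂.enum-sound y∈ = cong₂ _,_ (m+[n∸m]≡n a≤j) (m+[n∸m]≡n b≤m)
  enum-complete : ∀ {j m} p → weight p ≡ (j , m) → p ∈ enum j m
  enum-complete {j} {m} (x , y) eq with M₁.weight x in e₁ | M₂.weight y in e₂
  ... | (a , b) | (c , d) with eq
  ... | refl = ∈-concat≤⁺ (a + c) _ a (m≤m+n a c) (∈-concat≤⁺ (b + d) _ b (m≤m+n b d)
           (∈-cartesianProduct⁺ (M₁.enum-complete x e₁)
              (M₂.enum-complete y (trans e₂ (sym (cong₂ _,_ (m+n∸m≡n a c) (m+n∸m≡n b d)))))))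
  coefficient : ∀ j m → (f ⊛ g) j m ≡ + length (enum j m)
  coefficient j m = begin
    sum≤ j (λ a → sum≤ m (λ b → f a b *ℤ g (j ∸ a) (m ∸ b)))
      ≡⟨ sum≤-cong j (λ a → sum≤-cong m (λ b → product≡ a b)) ⟩
    sum≤ j (λ a → sum≤ m (λ b → + length (pairs j m a b)))
      ≡⟨ sum≤-cong j (λ a → trans (sum≤-+ m _) (cong +_ (sym (length-concat≤ m _)))) ⟩
    sum≤ j (λ a → + length (concat≤ m (λ b → pairs j m a b)))
      ≡⟨ trans (sum≤-+ j _) (cong +_ (sym (length-concat≤ j _))) ⟩
    + length (enum j m) ∎
    where
    open ≡-Reasoning
    product≡ : ∀ a b → f a b *ℤ g (j ∸ a) (m ∸ b) ≡ + length (pairs j m a b)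
    product≡ a b = begin
      f a b *ℤ g (j ∸ a) (m ∸ b)
        ≡⟨ cong₂ _*ℤ_ (M₁.coefficient a b) (M₂.coefficient (j ∸ a) (m ∸ b)) ⟩
      + length (M₁.enum a b) *ℤ + length (M₂.enum (j ∸ a) (m ∸ b))
        ≡⟨ sym (pos-* (length (M₁.enum a b)) _) ⟩
      + (length (M₁.enum a b) * length (M₂.enum (j ∸ a) (m ∸ b)))
        ≡⟨ cong +_ (sym (length-cartesianProduct (M₁.enum a b) _)) ⟩
      + length (pairs j m a b) ∎

⊕-model : ∀ {f g} → Model f → Model g → Model (f ⊕ g)
⊕-model {f} {g} M₁ M₂ = record
  { Obj = M₁.Obj ⊎ M₂.Obj ; weight = weight
  ; enum = enum ; enum-unique = enum-unique ; enum-sound = enum-sound ; enum-complete = enum-complete ; coefficient = coefficient }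
  where
  module M₁ = Model M₁
  module M₂ = Model M₂
  weight : M₁.Obj ⊎ M₂.Obj → ℕ × ℕ
  weight (inj₁ x) = M₁.weight x
  weight (inj₂ y) = M₂.weight y
  enum : ℕ → ℕ → List (M₁.Obj ⊎ M₂.Obj)
  enum j m = map inj₁ (M₁.enum j m) ++ map inj₂ (M₂.enum j m)
  enum-unique : ∀ j m → Unique (enum j m)
  enum-unique j m =
    Unique.++⁺ (Unique.map⁺ inj₁-injective (M₁.enum-unique j m)) (Unique.map⁺ inj₂-injective (M₂.enum-unique j m)) disjoint
    where
    inj₁-injective : ∀ {a b : M₁.Obj} → _≡_ {A = M₁.Obj ⊎ M₂.Obj} (inj₁ a) (inj₁ b) → a ≡ b
    inj₁-injective refl = refl
    inj₂-injective : ∀ {a b : M₂.Obj} → _≡_ {A = M₁.Obj ⊎ M₂.Obj} (inj₂ a) (inj₂ b) → a ≡ b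
    inj₂-injective refl = refl
    disjoint : ∀ {v} → v ∈ map inj₁ (M₁.enum j m) × v ∈ map inj₂ (M₂.enum j m) → ⊥
    disjoint (v∈₁ , v∈₂) with ∈-map⁻ inj₁ v∈₁ | ∈-map⁻ inj₂ v∈₂
    ... | _ , _ , refl | _ , _ , ()
  enum-sound : ∀ {j m p} → p ∈ enum j m → weight p ≡ (j , m)
  enum-sound {j} {m} p∈ with ∈-++⁻ (map inj₁ (M₁.enum j m)) p∈
  ... | inj₁ p∈₁ with ∈-map⁻ inj₁ p∈₁
  ...   | _ , x∈ , refl = M₁.enum-sound x∈
  enum-sound {j} {m} p∈ | inj₂ p∈₂ with ∈-map⁻ inj₂ p∈₂
  ...   | _ , y∈ , refl = M₂.enum-sound y∈
  enum-complete : ∀ {j m} p → weight p ≡ (j , m) → p ∈ enum j m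
  enum-complete (inj₁ x) w = ∈-++⁺ˡ (∈-map⁺ inj₁ (M₁.enum-complete x w))
  enum-complete {j} {m} (inj₂ y) w = ∈-++⁺ʳ (map inj₁ (M₁.enum j m)) (∈-map⁺ inj₂ (M₂.enum-complete y w))
  coefficient : ∀ j m → (f ⊕ g) j m ≡ + length (enum j m)
  coefficient j m = trans (cong₂ _+ℤ_ (M₁.coefficient j m) (M₂.coefficient j m))
    (cong +_ (sym (trans (length-++ (map inj₁ (M₁.enum j m)))
      (cong₂ _+_ (length-map inj₁ (M₁.enum j m)) (length-map inj₂ (M₂.enum j m))))))

prod<-model : (f : ℕ → Series) → (∀ i → Model (f i)) → ∀ r → Model (prod< r f)
prod<-model f M zero = mono-model 1 0 0
prod<-model f M (suc r) = ⊛-model (prod<-model f M r) (M r)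

concatMap-unique : {X Y : Set} (h : X → List Y) (key : Y → X) (xs : List X) → Unique xs →
  (∀ x → Unique (h x)) → (∀ x {y} → y ∈ h x → key y ≡ x) → Unique (concatMap h xs)
concatMap-unique h key [] u uh k = []
concatMap-unique h key (x ∷ xs) (x∉xs ∷ u) uh k = Unique.++⁺ (uh x) (concatMap-unique h key xs u uh k) disjoint
  where
  disjoint : ∀ {v} → v ∈ h x × v ∈ concatMap h xs → ⊥
  disjoint (v∈hx , v∈rest) = keys-differ xs x∉xs (∈-concatMap⁻ h {xs = xs} v∈rest)
    where
    keys-differ : ∀ zs → All (λ z → x ≢ z) zs → Any (λ z → _ ∈ h z) zs → ⊥
    keys-differ (z ∷ zs) (x≢z ∷ _) (here v∈hz) = x≢z (trans (sym (k x v∈hx)) (k z v∈hz))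
    keys-differ (z ∷ zs) (_ ∷ x∉zs) (there v∈) = keys-differ zs x∉zs v∈

head₀ : List ℕ → ℕ
head₀ [] = 0
head₀ (x ∷ _) = x

lists-unique : ∀ N b → Unique (lists N b)
lists-unique zero b = [] ∷ []
lists-unique (suc N) b = concatMap-unique (λ x → map (x ∷_) (lists N b)) head₀ (upTo (suc b)) (Unique.upTo⁺ (suc b))
  (λ x → Unique.map⁺ (λ e → proj₂ (∷-injective e)) (lists-unique N b))
  (λ x l∈ → let (_ , _ , e) = ∈-map⁻ (x ∷_) l∈ in cong head₀ e)

∈-lists : ∀ N b l → length l ≡ N → All (_≤ b) l → l ∈ lists N b
∈-lists zero b [] refl [] = here refl
∈-lists (suc N) b (x ∷ l) refl (p ∷ ps) =
  ∈-concatMap⁺ (λ y → map (y ∷_) (lists N b)) {xs = upTo (suc b)}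
    (Any.map (λ { refl → ∈-map⁺ (x ∷_) (∈-lists N b l refl ps) }) (∈-upTo⁺ {i = x} (s≤s p)))

All≤sum : ∀ l → All (_≤ sum l) l
All≤sum [] = []
All≤sum (x ∷ l) = m≤m+n x (sum l) ∷ All.map (λ {y} p → ≤-trans p (m≤n+m (sum l) x)) (All≤sum l)

suffixSums : List ℕ → List ℕ
suffixSums [] = []
suffixSums (d ∷ ds) = d + sum ds ∷ suffixSums ds

differences : List ℕ → List ℕ
differences [] = []
differences (x ∷ xs) = x ∸ head₀ xs ∷ differences xs

weightedSum : List ℕ → ℕ
weightedSum [] = 0
weightedSum (d ∷ ds) = d + sum ds + weightedSum ds

sumFirsts : List ℕ → ℕ
sumFirsts (x ∷ y ∷ z ∷ r) = x + sumFirsts r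
sumFirsts (x ∷ y ∷ []) = x
sumFirsts (x ∷ []) = x
sumFirsts [] = 0

sumSeconds : List ℕ → ℕ
sumSeconds (x ∷ y ∷ z ∷ r) = y + sumSeconds r
sumSeconds (x ∷ y ∷ []) = y
sumSeconds (x ∷ []) = 0
sumSeconds [] = 0

isTwo : ℕ → ℕ
isTwo y = if y ≡ᵇ 2 then 1 else 0

countTwoSeconds : List ℕ → ℕ
countTwoSeconds (x ∷ y ∷ z ∷ r) = isTwo y + countTwoSeconds r
countTwoSeconds (x ∷ y ∷ []) = isTwo y
countTwoSeconds (x ∷ []) = 0
countTwoSeconds [] = 0

lastPositive : List ℕ → Bool
lastPositive [] = true
lastPositive (x ∷ []) = 1 ≤ᵇ x
lastPositive (x ∷ y ∷ r) = lastPositive (y ∷ r)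

noDoubleZero : List ℕ → Bool
noDoubleZero (x ∷ y ∷ z ∷ r) = not ((x ≡ᵇ 0) ∧ (y ≡ᵇ 0)) ∧ noDoubleZero (y ∷ z ∷ r)
noDoubleZero _ = true

noThreeEqual : List ℕ → Bool
noThreeEqual (a ∷ b ∷ c ∷ r) = not ((a ≡ᵇ b) ∧ (b ≡ᵇ c)) ∧ noThreeEqual (b ∷ c ∷ r)
noThreeEqual _ = true

length-suffixSums : ∀ ds → length (suffixSums ds) ≡ length ds
length-suffixSums [] = refl
length-suffixSums (d ∷ ds) = cong suc (length-suffixSums ds)

suffixSums-decreasing : ∀ ds → T (weaklyDecreasing (suffixSums ds))
suffixSums-decreasing [] = tt
suffixSums-decreasing (a ∷ []) = tt
suffixSums-decreasing (a ∷ b ∷ r) = ∧-intro (≤⇒≤ᵇ (m≤n+m (b + sum r) a)) (suffixSums-decreasing (b ∷ r))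

sum-suffixSums : ∀ ds → sum (suffixSums ds) ≡ weightedSum ds
sum-suffixSums [] = refl
sum-suffixSums (d ∷ ds) = cong (λ u → d + sum ds + u) (sum-suffixSums ds)

head-suffixSums : ∀ ds → head₀ (suffixSums ds) ≡ sum ds
head-suffixSums [] = refl
head-suffixSums (d ∷ ds) = refl

suffixSums-positive⁺ : ∀ ds → T (lastPositive ds) → T (allPositive (suffixSums ds))
suffixSums-positive⁺ [] _ = tt
suffixSums-positive⁺ (x ∷ []) p = ∧-intro (≤⇒≤ᵇ (subst (1 ≤_) (sym (+-identityʳ x)) (≤ᵇ⇒≤ 1 x p))) tt
suffixSums-positive⁺ (x ∷ y ∷ r) p =
  let ih = suffixSums-positive⁺ (y ∷ r) p
      h1 = ≤ᵇ⇒≤ 1 _ (proj₁ (∧-elim ih))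
  in ∧-intro (≤⇒≤ᵇ (≤-trans h1 (m≤n+m _ x))) ih

suffixSums-positive⁻ : ∀ ds → T (allPositive (suffixSums ds)) → T (lastPositive ds)
suffixSums-positive⁻ [] _ = tt
suffixSums-positive⁻ (x ∷ []) p = ≤⇒≤ᵇ (subst (1 ≤_) (+-identityʳ x) (≤ᵇ⇒≤ 1 _ (proj₁ (∧-elim p))))
suffixSums-positive⁻ (x ∷ y ∷ r) p = suffixSums-positive⁻ (y ∷ r) (proj₂ (∧-elim {1 ≤ᵇ (x + (y + sum r))} p))

Σ₁-suffixSums : ∀ ds → Σ₁ (suffixSums ds) ≡ sumFirsts ds
Σ₁-suffixSums [] = refl
Σ₁-suffixSums (x ∷ []) = trans (+-identityʳ _) (+-identityʳ x)
Σ₁-suffixSums (x ∷ y ∷ []) = trans (+-identityʳ _) (m+n∸n≡m x (y + 0))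
Σ₁-suffixSums (x ∷ y ∷ z ∷ r) = cong₂ _+_ (m+n∸n≡m x (y + (z + sum r))) (Σ₁-suffixSums r)

Σ₂-suffixSums : ∀ ds → Σ₂ (suffixSums ds) ≡ sumSeconds ds
Σ₂-suffixSums [] = refl
Σ₂-suffixSums (x ∷ []) = refl
Σ₂-suffixSums (x ∷ y ∷ []) = trans (+-identityʳ (y + 0 ∸ 0)) (+-identityʳ y)
Σ₂-suffixSums (x ∷ y ∷ z ∷ r) = cong₂ _+_ (m+n∸n≡m y (z + sum r)) (Σ₂-suffixSums r)

unitsWithGap2-suffixSums : ∀ ds → unitsWithGap2 (suffixSums ds) ≡ countTwoSeconds ds
unitsWithGap2-suffixSums [] = refl
unitsWithGap2-suffixSums (x ∷ []) = refl
unitsWithGap2-suffixSums (x ∷ y ∷ []) rewrite +-identityʳ y with y ≡ᵇ 2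
... | true = refl
... | false = refl
unitsWithGap2-suffixSums (x ∷ y ∷ z ∷ r) rewrite m+n∸n≡m y (z + sum r) with y ≡ᵇ 2
... | true = cong suc (unitsWithGap2-suffixSums r)
... | false = unitsWithGap2-suffixSums r

+≡ᵇ-self : ∀ x B → (x + B ≡ᵇ B) ≡ (x ≡ᵇ 0)
+≡ᵇ-self x zero rewrite +-identityʳ x = refl
+≡ᵇ-self x (suc B) rewrite +-suc x B = +≡ᵇ-self x B

noThreeEqual-suffixSums : ∀ ds → noThreeEqual (suffixSums ds) ≡ noDoubleZero ds
noThreeEqual-suffixSums [] = refl
noThreeEqual-suffixSums (x ∷ []) = refl
noThreeEqual-suffixSums (x ∷ y ∷ []) = refl
noThreeEqual-suffixSums (x ∷ y ∷ z ∷ r) =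
  cong₂ (λ u v → not u ∧ v)
    (cong₂ _∧_ (+≡ᵇ-self x (y + (z + sum r))) (+≡ᵇ-self y (z + sum r))) (noThreeEqual-suffixSums (y ∷ z ∷ r))

differences-suffixSums : ∀ ds → differences (suffixSums ds) ≡ ds
differences-suffixSums [] = refl
differences-suffixSums (d ∷ ds) rewrite head-suffixSums ds = cong₂ _∷_ (m+n∸n≡m d (sum ds)) (differences-suffixSums ds)

decreasing-tail : ∀ x xs → T (weaklyDecreasing (x ∷ xs)) → T (weaklyDecreasing xs)
decreasing-tail x [] _ = tt
decreasing-tail x (y ∷ xs) w = proj₂ (∧-elim {y ≤ᵇ x} w)

decreasing-head : ∀ x xs → T (weaklyDecreasing (x ∷ xs)) → head₀ xs ≤ x
decreasing-head x [] _ = z≤n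
decreasing-head x (y ∷ xs) w = ≤ᵇ⇒≤ y x (proj₁ (∧-elim {y ≤ᵇ x} w))

sum-differences : ∀ xs → T (weaklyDecreasing xs) → sum (differences xs) ≡ head₀ xs
sum-differences [] _ = refl
sum-differences (x ∷ xs) w =
  trans (cong (λ u → x ∸ head₀ xs + u) (sum-differences xs (decreasing-tail x xs w))) (m∸n+n≡m (decreasing-head x xs w))

suffixSums-differences : ∀ xs → T (weaklyDecreasing xs) → suffixSums (differences xs) ≡ xs
suffixSums-differences [] _ = refl
suffixSums-differences (x ∷ xs) w = cong₂ _∷_ (sum-differences (x ∷ xs) w) (suffixSums-differences xs (decreasing-tail x xs w))

allB-intro : {A : Set} (p : A → Bool) (l : List A) → (∀ x → T (p x)) → T (allB p l)
allB-intro p [] h = tt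
allB-intro p (x ∷ l) h = ∧-intro (h x) (allB-intro p l h)

allB-mono : {A : Set} (p q : A → Bool) (l : List A) → (∀ x → T (p x) → T (q x)) → T (allB p l) → T (allB q l)
allB-mono p q [] h _ = tt
allB-mono p q (x ∷ l) h a = let (a1 , a2) = ∧-elim {p x} a in ∧-intro (h x a1) (allB-mono p q l h a2)

count-∷ : ∀ x a l → count x l ≤ count x (a ∷ l)
count-∷ x a l = m≤n+m (count x l) (if x ≡ᵇ a then 1 else 0)

≤ᵇ-trans : ∀ a b c → a ≤ b → T (b ≤ᵇ c) → T (a ≤ᵇ c)
≤ᵇ-trans a b c le t = ≤⇒≤ᵇ (≤-trans le (≤ᵇ⇒≤ b c t))

atMostTwice-tail : ∀ a l → T (atMostTwice (a ∷ l)) → T (atMostTwice l)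
atMostTwice-tail a l t = allB-mono (λ x → count x (a ∷ l) ≤ᵇ 2) (λ x → count x l ≤ᵇ 2) l
  (λ x → ≤ᵇ-trans (count x l) (count x (a ∷ l)) 2 (count-∷ x a l)) (proj₂ (∧-elim {count a (a ∷ l) ≤ᵇ 2} t))

≡ᵇ-refl : ∀ a → (a ≡ᵇ a) ≡ true
≡ᵇ-refl zero = refl
≡ᵇ-refl (suc a) = ≡ᵇ-refl a

T-not : ∀ {x} → (T x → ⊥) → T (not x)
T-not {true} h = h tt
T-not {false} h = tt

atMostTwice-no-triple : ∀ a r → T (atMostTwice (a ∷ a ∷ a ∷ r)) → ⊥
atMostTwice-no-triple a r t = contra (≤ᵇ⇒≤ _ 2 (proj₁ (∧-elim {count a (a ∷ a ∷ a ∷ r) ≤ᵇ 2} t)))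
  where
  contra : count a (a ∷ a ∷ a ∷ r) ≤ 2 → ⊥
  contra le rewrite ≡ᵇ-refl a with le
  ... | s≤s (s≤s ())

atMostTwice⇒noThreeEqual : ∀ l → T (atMostTwice l) → T (noThreeEqual l)
atMostTwice⇒noThreeEqual [] _ = tt
atMostTwice⇒noThreeEqual (a ∷ []) _ = tt
atMostTwice⇒noThreeEqual (a ∷ b ∷ []) _ = tt
atMostTwice⇒noThreeEqual (a ∷ b ∷ c ∷ r) t =
  ∧-intro first (atMostTwice⇒noThreeEqual (b ∷ c ∷ r) (atMostTwice-tail a (b ∷ c ∷ r) t))
  where
  first : T (not ((a ≡ᵇ b) ∧ (b ≡ᵇ c)))
  first = T-not (λ h → let (p , q) = ∧-elim {a ≡ᵇ b} h in
     atMostTwice-no-triple a r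
       (subst₂ (λ u v → T (atMostTwice (a ∷ u ∷ v ∷ r))) (sym (≡ᵇ⇒≡ a b p)) (sym (trans (≡ᵇ⇒≡ a b p) (≡ᵇ⇒≡ b c q))) t))

≢⇒≡ᵇ-false : ∀ x b → x ≢ b → (x ≡ᵇ b) ≡ false
≢⇒≡ᵇ-false x b ne with x ≡ᵇ b in e
... | true = ⊥-elim (ne (≡ᵇ⇒≡ x b (subst T (sym e) tt)))
... | false = refl

count-above-head : ∀ x b r → T (weaklyDecreasing (b ∷ r)) → b < x → count x (b ∷ r) ≡ 0
count-above-head x b [] w lt rewrite ≢⇒≡ᵇ-false x b (λ e → <-irrefl (sym e) lt) = refl
count-above-head x b (c ∷ r) w lt rewrite ≢⇒≡ᵇ-false x b (λ e → <-irrefl (sym e) lt) =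
  count-above-head x c r (decreasing-tail b (c ∷ r) w) (≤-<-trans (decreasing-head b (c ∷ r) w) lt)

noThreeEqual-tail : ∀ a r → T (noThreeEqual (a ∷ r)) → T (noThreeEqual r)
noThreeEqual-tail a [] _ = tt
noThreeEqual-tail a (b ∷ []) _ = tt
noThreeEqual-tail a (b ∷ c ∷ r) t = proj₂ (∧-elim {not ((a ≡ᵇ b) ∧ (b ≡ᵇ c))} t)

count≤2 : ∀ l → T (weaklyDecreasing l) → T (noThreeEqual l) → ∀ x → count x l ≤ 2
count≤2 [] w n x = z≤n
count≤2 (a ∷ r) w n x with x ≟ a
... | no ne rewrite ≢⇒≡ᵇ-false x a ne = count≤2 r (decreasing-tail a r w) (noThreeEqual-tail a r n) x
... | yes refl rewrite ≡ᵇ-refl x = s≤s (count-after-first r w n)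
  where
  count-after-first : ∀ r → T (weaklyDecreasing (x ∷ r)) → T (noThreeEqual (x ∷ r)) → count x r ≤ 1
  count-after-first [] w n = z≤n
  count-after-first (b ∷ r′) w n with m≤n⇒m<n∨m≡n (decreasing-head x (b ∷ r′) w)
  ... | inj₁ b<x = m≤n⇒m≤1+n (≤-reflexive (count-above-head x b r′ (decreasing-tail x (b ∷ r′) w) b<x))
  ... | inj₂ refl rewrite ≡ᵇ-refl b = s≤s (count-after-second r′ w n)
    where
    count-after-second : ∀ r′ → T (weaklyDecreasing (b ∷ b ∷ r′)) → T (noThreeEqual (b ∷ b ∷ r′)) → count b r′ ≤ 0
    count-after-second [] w n = z≤n
    count-after-second (c ∷ r″) w n with m≤n⇒m<n∨m≡n (decreasing-head b (c ∷ r″) (decreasing-tail b (b ∷ c ∷ r″) w))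
    ... | inj₁ c<b = ≤-reflexive (count-above-head b c r″ (decreasing-tail b (c ∷ r″) (decreasing-tail b (b ∷ c ∷ r″) w)) c<b)
    ... | inj₂ refl rewrite ≡ᵇ-refl c = ⊥-elim (proj₁ (∧-elim {false} {noThreeEqual (c ∷ c ∷ r″)} n))

noThreeEqual⇒atMostTwice : ∀ l → T (weaklyDecreasing l) → T (noThreeEqual l) → T (atMostTwice l)
noThreeEqual⇒atMostTwice l w n = allB-intro _ l (λ x → ≤⇒≤ᵇ (count≤2 l w n x))


record Shape (N : ℕ) (δ : List ℕ) : Set where
  field
    length≡ : length δ ≡ N
    last-positive : T (lastPositive δ)
    no-double-zero : T (noDoubleZero δ)
    seconds≡2 : sumSeconds δ ≡ 2
    twos≡1 : countTwoSeconds δ ≡ 1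

partitionsB : ℕ → ℕ → ℕ → List (List ℕ)
partitionsB N j m = filter (λ l → T? (isBN N j m l)) (lists N m)

partitionsB-unique : ∀ N j m → Unique (partitionsB N j m)
partitionsB-unique N j m = Unique.filter⁺ (λ l → T? (isBN N j m l)) (lists-unique N m)

suffixSums-∈-partitionsB : ∀ {N j m δ} → Shape N δ → sumFirsts δ ≡ j → weightedSum δ ≡ m →
  suffixSums δ ∈ partitionsB N j m
suffixSums-∈-partitionsB {N} {j} {m} {δ} sh firsts weighted =
  ∈-filter⁺ (λ l → T? (isBN N j m l))
    (∈-lists N m (suffixSums δ) length≡′ (subst (λ b → All (_≤ b) (suffixSums δ)) sum≡ (All≤sum (suffixSums δ))))
    (∧-intro (≡⇒≡ᵇ _ _ length≡′)
    (∧-intro (suffixSums-decreasing δ)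
    (∧-intro (suffixSums-positive⁺ δ last-positive)
    (∧-intro (≡⇒≡ᵇ _ _ sum≡)
    (∧-intro (≡⇒≡ᵇ _ _ (trans (Σ₁-suffixSums δ) firsts))
    (∧-intro (noThreeEqual⇒atMostTwice (suffixSums δ) (suffixSums-decreasing δ)
               (subst T (sym (noThreeEqual-suffixSums δ)) no-double-zero))
    (∧-intro (≡⇒≡ᵇ _ _ (trans (Σ₂-suffixSums δ) seconds≡2))
             (≡⇒≡ᵇ _ _ (trans (unitsWithGap2-suffixSums δ) twos≡1)))))))))
  where
  open Shape sh
  length≡′ = trans (length-suffixSums δ) length≡
  sum≡ = trans (sum-suffixSums δ) weighted

∈-partitionsB⇒ : ∀ {N j m l} → l ∈ partitionsB N j m →
  suffixSums (differences l) ≡ l × Shape N (differences l) × sumFirsts (differences l) ≡ j × weightedSum (differences l) ≡ m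
∈-partitionsB⇒ {N} {j} {m} {l} l∈ =
  let (len , t₁) = ∧-elim {length l ≡ᵇ N} (proj₂ (∈-filter⁻ (λ l → T? (isBN N j m l)) {xs = lists N m} l∈))
      (dec , t₂) = ∧-elim {weaklyDecreasing l} t₁
      (pos , t₃) = ∧-elim {allPositive l} t₂
      (sm , t₄) = ∧-elim {sum l ≡ᵇ m} t₃
      (s₁ , t₅) = ∧-elim {Σ₁ l ≡ᵇ j} t₄
      (amt , t₆) = ∧-elim {atMostTwice l} t₅
      (s₂ , g₂) = ∧-elim {Σ₂ l ≡ᵇ 2} t₆
      δ = differences l
      l≡ = suffixSums-differences l dec
      on-δ : (P : List ℕ → Set) → P l → P (suffixSums δ)
      on-δ P = subst P (sym l≡)
  in l≡ ,
     record
       { length≡ = trans (sym (length-suffixSums δ)) (≡ᵇ⇒≡ _ _ (on-δ (λ u → T (length u ≡ᵇ N)) len))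
       ; last-positive = suffixSums-positive⁻ δ (on-δ (λ u → T (allPositive u)) pos)
       ; no-double-zero = subst T (noThreeEqual-suffixSums δ)
                          (atMostTwice⇒noThreeEqual (suffixSums δ) (on-δ (λ u → T (atMostTwice u)) amt))
       ; seconds≡2 = trans (sym (Σ₂-suffixSums δ)) (≡ᵇ⇒≡ _ _ (on-δ (λ u → T (Σ₂ u ≡ᵇ 2)) s₂))
       ; twos≡1 = trans (sym (unitsWithGap2-suffixSums δ)) (≡ᵇ⇒≡ _ _ (on-δ (λ u → T (unitsWithGap2 u ≡ᵇ 1)) g₂))
       } ,
     trans (sym (Σ₁-suffixSums δ)) (≡ᵇ⇒≡ _ _ (on-δ (λ u → T (Σ₁ u ≡ᵇ j)) s₁)) ,
     trans (sym (sum-suffixSums δ)) (≡ᵇ⇒≡ _ _ (on-δ (λ u → T (sum u ≡ᵇ m)) sm))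

-- Objects of s whose weight (z-exponent, q-exponent) is (Σ₁ + 1, |λ|), in bijection with
-- the difference lists of shape N. The shift by one is the division by z.
record DiffEncoding (N : ℕ) (s : Series) : Set₁ where
  field
    model : Model s
  open Model model public
  field
    toDiffs : Obj → List ℕ
    toDiffs-shape : ∀ x → Shape N (toDiffs x)
    weight-toDiffs : ∀ x → weight x ≡ (suc (sumFirsts (toDiffs x)) , weightedSum (toDiffs x))
    fromDiffs : List ℕ → Obj
    fromDiffs-toDiffs : ∀ x → fromDiffs (toDiffs x) ≡ x
    toDiffs-fromDiffs : ∀ δ → Shape N δ → toDiffs (fromDiffs δ) ≡ δ

B≈divZ : ∀ {N s} → DiffEncoding N s → B N ≈ divZ s
B≈divZ {N} {s} E j m =
  trans (cong +_ (sym (length≡-of-inverses (enum (suc j) m) (partitionsB N j m) (enum-unique (suc j) m) (partitionsB-unique N j m)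
                         encode decode decode-encode encode∈ decode∈ encode-decode)))
        (sym (coefficient (suc j) m))
  where
  open DiffEncoding E
  encode : Obj → List ℕ
  encode x = suffixSums (toDiffs x)
  decode : List ℕ → Obj
  decode l = fromDiffs (differences l)
  decode-encode : ∀ x → decode (encode x) ≡ x
  decode-encode x = trans (cong fromDiffs (differences-suffixSums (toDiffs x))) (fromDiffs-toDiffs x)
  encode∈ : ∀ {x} → x ∈ enum (suc j) m → encode x ∈ partitionsB N j m
  encode∈ {x} x∈ = suffixSums-∈-partitionsB (toDiffs-shape x)
    (suc-injective (cong proj₁ w)) (cong proj₂ w)
    where
    w = trans (sym (weight-toDiffs x)) (enum-sound x∈)
  decode∈ : ∀ {l} → l ∈ partitionsB N j m → decode l ∈ enum (suc j) m
  decode∈ {l} l∈ with ∈-partitionsB⇒ l∈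
  ... | _ , sh , firsts , weighted = enum-complete (decode l) (begin
    weight (decode l)
      ≡⟨ weight-toDiffs (decode l) ⟩
    (suc (sumFirsts (toDiffs (decode l))) , weightedSum (toDiffs (decode l)))
      ≡⟨ cong (λ δ → (suc (sumFirsts δ) , weightedSum δ)) (toDiffs-fromDiffs (differences l) sh) ⟩
    (suc (sumFirsts (differences l)) , weightedSum (differences l))
      ≡⟨ cong₂ (λ a b → (suc a , b)) firsts weighted ⟩
    (suc j , m) ∎)
    where open ≡-Reasoning
  encode-decode : ∀ {l} → l ∈ partitionsB N j m → encode (decode l) ≡ l
  encode-decode {l} l∈ with ∈-partitionsB⇒ l∈
  ... | l≡ , sh , _ = trans (cong suffixSums (toDiffs-fromDiffs (differences l) sh)) l≡

Pairs : Set
Pairs = List (ℕ × ℕ)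

plainUnits : Pairs → List ℕ → List ℕ
plainUnits [] tl = tl
plainUnits ((d , e) ∷ ps) tl = suc d ∷ 0 ∷ suc e ∷ plainUnits ps tl

-- The special unit (d, 2, e) sits at index p. When it closes the list its third entry is
-- δ_N ≥ 1, so it is stored as e + 1 (the extra q^(3n+3) of the last case).
specialThird : Pairs → List ℕ → ℕ → ℕ
specialThird [] [] e = suc e
specialThird [] (_ ∷ _) e = e
specialThird (_ ∷ _) _ e = e

unitsWithTwoAt : ℕ → Pairs → List ℕ → List ℕ
unitsWithTwoAt p [] tl = tl
unitsWithTwoAt zero ((d , e) ∷ ps) tl = d ∷ 2 ∷ specialThird ps tl e ∷ plainUnits ps tl
unitsWithTwoAt (suc p) ((d , e) ∷ ps) tl = suc d ∷ 0 ∷ suc e ∷ unitsWithTwoAt p ps tl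

splitPlainUnits : ℕ → List ℕ → Pairs × List ℕ
splitPlainUnits zero δ = ([] , δ)
splitPlainUnits (suc k) (x ∷ y ∷ z ∷ r) = let (ps , tl) = splitPlainUnits k r in ((x ∸ 1 , z ∸ 1) ∷ ps , tl)
splitPlainUnits (suc k) _ = ([] , [])

specialThird⁻¹ : ℕ → List ℕ → ℕ → ℕ
specialThird⁻¹ zero [] z = z ∸ 1
specialThird⁻¹ zero (_ ∷ _) z = z
specialThird⁻¹ (suc _) _ z = z

splitUnits : ℕ → List ℕ → ℕ × Pairs × List ℕ
splitUnits zero δ = (0 , [] , δ)
splitUnits (suc k) (x ∷ y ∷ z ∷ r) =
  if y ≡ᵇ 0 then (let (p , ps , tl) = splitUnits k r in (suc p , (x ∸ 1 , z ∸ 1) ∷ ps , tl))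
  else (let (ps , tl) = splitPlainUnits k r in (0 , (x , specialThird⁻¹ k r z) ∷ ps , tl))
splitUnits (suc k) _ = (0 , [] , [])

splitPlainUnits-plainUnits : ∀ {k} ps tl → length ps ≡ k → splitPlainUnits k (plainUnits ps tl) ≡ (ps , tl)
splitPlainUnits-plainUnits [] tl refl = refl
splitPlainUnits-plainUnits ((d , e) ∷ ps) tl refl rewrite splitPlainUnits-plainUnits ps tl refl = refl

specialThird⁻¹-specialThird : ∀ ps tl e → specialThird⁻¹ (length ps) (plainUnits ps tl) (specialThird ps tl e) ≡ e
specialThird⁻¹-specialThird [] [] e = refl
specialThird⁻¹-specialThird [] (_ ∷ _) e = refl
specialThird⁻¹-specialThird (_ ∷ _) _ e = refl

splitUnits-unitsWithTwoAt : ∀ {k} p ps tl → length ps ≡ k → p ≤ k → splitUnits k (unitsWithTwoAt p ps tl) ≡ (p , ps , tl)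
splitUnits-unitsWithTwoAt zero [] tl refl _ = refl
splitUnits-unitsWithTwoAt zero ((d , e) ∷ ps) tl refl _
  rewrite splitPlainUnits-plainUnits ps tl refl | specialThird⁻¹-specialThird ps tl e = refl
splitUnits-unitsWithTwoAt (suc p) ((d , e) ∷ ps) tl refl (s≤s p≤k)
  rewrite splitUnits-unitsWithTwoAt p ps tl refl p≤k = refl

-- weightD ps = Σᵢ dᵢ (3i + 1) and weightE ps = Σᵢ eᵢ (3i + 3), the q-exponents that
-- 1/(zq; q³) and 1/(q³; q³) attach to the pairs.
sumD sumE weightD weightE : Pairs → ℕ
sumD [] = 0
sumD ((d , e) ∷ ps) = d + sumD ps
sumE [] = 0
sumE ((d , e) ∷ ps) = e + sumE ps
weightD [] = 0
weightD ((d , e) ∷ ps) = d + 3 * sumD ps + weightD ps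
weightE [] = 0
weightE ((d , e) ∷ ps) = 3 * e + 3 * sumE ps + weightE ps

twoAt : ℕ → Pairs → ℕ
twoAt p [] = 0
twoAt zero (_ ∷ _) = 1
twoAt (suc p) (_ ∷ ps) = twoAt p ps

specialBump : ℕ → Pairs → List ℕ → ℕ
specialBump p [] tl = 0
specialBump zero (_ ∷ ps) tl = specialThird ps tl 0
specialBump (suc p) (_ ∷ ps) tl = specialBump p ps tl

3*suc≡suc³ : ∀ k t → suc (suc (suc (3 * k + t))) ≡ 3 * suc k + t
3*suc≡suc³ = solve-∀

length-plainUnits : ∀ ps tl → length (plainUnits ps tl) ≡ 3 * length ps + length tl
length-plainUnits [] tl = refl
length-plainUnits ((d , e) ∷ ps) tl rewrite length-plainUnits ps tl = 3*suc≡suc³ (length ps) (length tl)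

length-unitsWithTwoAt : ∀ p ps tl → length (unitsWithTwoAt p ps tl) ≡ 3 * length ps + length tl
length-unitsWithTwoAt p [] tl = refl
length-unitsWithTwoAt zero ((d , e) ∷ ps) tl rewrite length-plainUnits ps tl = 3*suc≡suc³ (length ps) (length tl)
length-unitsWithTwoAt (suc p) ((d , e) ∷ ps) tl rewrite length-unitsWithTwoAt p ps tl = 3*suc≡suc³ (length ps) (length tl)

sumFirsts-unit-step : ∀ d a k s → suc d + (a + k + s) ≡ d + a + suc k + s
sumFirsts-unit-step = solve-∀

sumFirsts-plainUnits : ∀ {k} ps tl → length ps ≡ k → sumFirsts (plainUnits ps tl) ≡ sumD ps + k + sumFirsts tl
sumFirsts-plainUnits [] tl refl = refl
sumFirsts-plainUnits ((d , e) ∷ ps) tl refl rewrite sumFirsts-plainUnits ps tl refl =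
  sumFirsts-unit-step d (sumD ps) (length ps) (sumFirsts tl)

sumFirsts-unitsWithTwoAt : ∀ p ps tl → sumFirsts (unitsWithTwoAt p ps tl) + twoAt p ps ≡ sumD ps + length ps + sumFirsts tl
sumFirsts-unitsWithTwoAt p [] tl = +-identityʳ _
sumFirsts-unitsWithTwoAt zero ((d , e) ∷ ps) tl rewrite sumFirsts-plainUnits ps tl refl = arith d (sumD ps) (length ps) (sumFirsts tl)
  where
  arith : ∀ d a k s → d + (a + k + s) + 1 ≡ d + a + suc k + s
  arith = solve-∀
sumFirsts-unitsWithTwoAt (suc p) ((d , e) ∷ ps) tl = trans (+-assoc (suc d) (sumFirsts (unitsWithTwoAt p ps tl)) (twoAt p ps))
  (trans (cong (λ u → suc d + u) (sumFirsts-unitsWithTwoAt p ps tl)) (sumFirsts-unit-step d (sumD ps) (length ps) (sumFirsts tl)))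

sumSeconds-plainUnits : ∀ ps tl → sumSeconds (plainUnits ps tl) ≡ sumSeconds tl
sumSeconds-plainUnits [] tl = refl
sumSeconds-plainUnits ((d , e) ∷ ps) tl = sumSeconds-plainUnits ps tl

sumSeconds-unitsWithTwoAt : ∀ p ps tl → sumSeconds (unitsWithTwoAt p ps tl) ≡ 2 * twoAt p ps + sumSeconds tl
sumSeconds-unitsWithTwoAt p [] tl = refl
sumSeconds-unitsWithTwoAt zero ((d , e) ∷ ps) tl = cong (λ u → 2 + u) (sumSeconds-plainUnits ps tl)
sumSeconds-unitsWithTwoAt (suc p) ((d , e) ∷ ps) tl = sumSeconds-unitsWithTwoAt p ps tl

countTwoSeconds-plainUnits : ∀ ps tl → countTwoSeconds (plainUnits ps tl) ≡ countTwoSeconds tl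
countTwoSeconds-plainUnits [] tl = refl
countTwoSeconds-plainUnits ((d , e) ∷ ps) tl = countTwoSeconds-plainUnits ps tl

countTwoSeconds-unitsWithTwoAt : ∀ p ps tl → countTwoSeconds (unitsWithTwoAt p ps tl) ≡ twoAt p ps + countTwoSeconds tl
countTwoSeconds-unitsWithTwoAt p [] tl = refl
countTwoSeconds-unitsWithTwoAt zero ((d , e) ∷ ps) tl = cong suc (countTwoSeconds-plainUnits ps tl)
countTwoSeconds-unitsWithTwoAt (suc p) ((d , e) ∷ ps) tl = countTwoSeconds-unitsWithTwoAt p ps tl

sum-plainUnits : ∀ ps tl → sum (plainUnits ps tl) ≡ sumD ps + sumE ps + 2 * length ps + sum tl
sum-plainUnits [] tl = refl
sum-plainUnits ((d , e) ∷ ps) tl rewrite sum-plainUnits ps tl = arith d e (sumD ps) (sumE ps) (length ps) (sum tl)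
  where
  arith : ∀ d e a b k s → suc d + (0 + (suc e + (a + b + 2 * k + s))) ≡ d + a + (e + b) + 2 * suc k + s
  arith = solve-∀

specialThird-+ : ∀ ps tl e → specialThird ps tl e ≡ e + specialThird ps tl 0
specialThird-+ [] [] e = trans (cong suc (sym (+-identityʳ e))) (sym (+-suc e 0))
specialThird-+ [] (_ ∷ _) e = sym (+-identityʳ e)
specialThird-+ (_ ∷ _) _ e = sym (+-identityʳ e)

sum-unitsWithTwoAt : ∀ p ps tl → sum (unitsWithTwoAt p ps tl) ≡ sumD ps + sumE ps + 2 * length ps + sum tl + specialBump p ps tl
sum-unitsWithTwoAt p [] tl = sym (+-identityʳ _)
sum-unitsWithTwoAt zero ((d , e) ∷ ps) tl rewrite specialThird-+ ps tl e | sum-plainUnits ps tl =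
  arith d e (sumD ps) (sumE ps) (length ps) (sum tl) (specialThird ps tl 0)
  where
  arith : ∀ d e a b k s z → d + (2 + (e + z + (a + b + 2 * k + s))) ≡ d + a + (e + b) + 2 * suc k + s + z
  arith = solve-∀
sum-unitsWithTwoAt (suc p) ((d , e) ∷ ps) tl rewrite sum-unitsWithTwoAt p ps tl =
  arith d e (sumD ps) (sumE ps) (length ps) (sum tl) (specialBump p ps tl)
  where
  arith : ∀ d e a b k s z → suc d + (0 + (suc e + (a + b + 2 * k + s + z))) ≡ d + a + (e + b) + 2 * suc k + s + z
  arith = solve-∀

-- The summand 3k² + k is the weight of k plain units whose pairs are all zero.
weightedSum-plainUnits : ∀ {k} ps tl → length ps ≡ k →
  weightedSum (plainUnits ps tl) ≡ weightD ps + weightE ps + (3 * k * k + k) + 3 * k * sum tl + weightedSum tl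
weightedSum-plainUnits [] tl refl = refl
weightedSum-plainUnits ((d , e) ∷ ps) tl refl rewrite sum-plainUnits ps tl | weightedSum-plainUnits ps tl refl =
  arith d e (sumD ps) (sumE ps) (weightD ps) (weightE ps) (length ps) (sum tl) (weightedSum tl)
  where
  arith : ∀ d e a b wd we k s w →
    suc d + (0 + (suc e + (a + b + 2 * k + s)))
      + (0 + (suc e + (a + b + 2 * k + s)) + (suc e + (a + b + 2 * k + s) + (wd + we + (3 * k * k + k) + 3 * k * s + w)))
    ≡ d + 3 * a + wd + (3 * e + 3 * b + we) + (3 * suc k * suc k + suc k) + 3 * suc k * s + w
  arith = solve-∀

weightedSum-unitsWithTwoAt : ∀ {k} p ps tl → length ps ≡ k →
  weightedSum (unitsWithTwoAt p ps tl)
    ≡ weightD ps + weightE ps + (3 * k * k + k) + 3 * k * specialBump p ps tl + 3 * k * sum tl + weightedSum tl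
weightedSum-unitsWithTwoAt p [] tl refl = refl
weightedSum-unitsWithTwoAt zero ((d , e) ∷ []) [] refl = arith d e
  where
  arith : ∀ d e → d + (2 + (suc e + 0)) + (2 + (suc e + 0) + (suc e + 0 + 0))
                  ≡ d + 3 * 0 + 0 + (3 * e + 3 * 0 + 0) + (3 * 1 * 1 + 1) + 3 * 1 * 1 + 3 * 1 * 0 + 0
  arith = solve-∀
weightedSum-unitsWithTwoAt zero ((d , e) ∷ []) (t ∷ tl) refl = arith d e (sum (t ∷ tl)) (weightedSum (t ∷ tl))
  where
  arith : ∀ d e s w → d + (2 + (e + s)) + (2 + (e + s) + (e + s + w))
                      ≡ d + 3 * 0 + 0 + (3 * e + 3 * 0 + 0) + (3 * 1 * 1 + 1) + 3 * 1 * 0 + 3 * 1 * s + w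
  arith = solve-∀
weightedSum-unitsWithTwoAt zero ((d , e) ∷ (q ∷ ps)) tl refl
  rewrite sum-plainUnits (q ∷ ps) tl | weightedSum-plainUnits (q ∷ ps) tl refl =
  arith d e (sumD (q ∷ ps)) (sumE (q ∷ ps)) (weightD (q ∷ ps)) (weightE (q ∷ ps)) (length (q ∷ ps)) (sum tl) (weightedSum tl)
  where
  arith : ∀ d e a b wd we k s w →
    d + (2 + (e + (a + b + 2 * k + s)))
      + (2 + (e + (a + b + 2 * k + s)) + (e + (a + b + 2 * k + s) + (wd + we + (3 * k * k + k) + 3 * k * s + w)))
    ≡ d + 3 * a + wd + (3 * e + 3 * b + we) + (3 * suc k * suc k + suc k) + 3 * suc k * 0 + 3 * suc k * s + w
  arith = solve-∀
weightedSum-unitsWithTwoAt (suc p) ((d , e) ∷ ps) tl refl rewrite sum-unitsWithTwoAt p ps tl | weightedSum-unitsWithTwoAt p ps tl refl =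
  arith d e (sumD ps) (sumE ps) (weightD ps) (weightE ps) (length ps) (sum tl) (weightedSum tl) (specialBump p ps tl)
  where
  arith : ∀ d e a b wd we k s w z →
    suc d + (0 + (suc e + (a + b + 2 * k + s + z)))
      + (0 + (suc e + (a + b + 2 * k + s + z))
         + (suc e + (a + b + 2 * k + s + z) + (wd + we + (3 * k * k + k) + 3 * k * z + 3 * k * s + w)))
    ≡ d + 3 * a + wd + (3 * e + 3 * b + we) + (3 * suc k * suc k + suc k) + 3 * suc k * z + 3 * suc k * s + w
  arith = solve-∀

lastPositive-∷ : ∀ c r → T (lastPositive r) → (r ≡ [] → 1 ≤ c) → T (lastPositive (c ∷ r))
lastPositive-∷ c [] _ h = ≤⇒≤ᵇ (h refl)
lastPositive-∷ c (x ∷ r) t _ = t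

plainUnits-lastPositive : ∀ ps tl → T (lastPositive tl) → T (lastPositive (plainUnits ps tl))
plainUnits-lastPositive [] tl t = t
plainUnits-lastPositive ((d , e) ∷ ps) tl t =
  lastPositive-∷ (suc e) (plainUnits ps tl) (plainUnits-lastPositive ps tl t) (λ _ → s≤s z≤n)

unitsWithTwoAt-lastPositive : ∀ p ps tl → T (lastPositive tl) → T (lastPositive (unitsWithTwoAt p ps tl))
unitsWithTwoAt-lastPositive p [] tl t = t
unitsWithTwoAt-lastPositive zero ((d , e) ∷ []) [] t = tt
unitsWithTwoAt-lastPositive zero ((d , e) ∷ []) (x ∷ tl) t = t
unitsWithTwoAt-lastPositive zero ((d , e) ∷ (q ∷ ps)) tl t =
  lastPositive-∷ e (plainUnits (q ∷ ps) tl) (plainUnits-lastPositive (q ∷ ps) tl t) (λ ())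
unitsWithTwoAt-lastPositive (suc p) ((d , e) ∷ ps) tl t =
  lastPositive-∷ (suc e) (unitsWithTwoAt p ps tl) (unitsWithTwoAt-lastPositive p ps tl t) (λ _ → s≤s z≤n)

noDoubleZero-tail : ∀ x r → T (noDoubleZero (x ∷ r)) → T (noDoubleZero r)
noDoubleZero-tail x [] _ = tt
noDoubleZero-tail x (y ∷ []) _ = tt
noDoubleZero-tail x (y ∷ z ∷ r) t = proj₂ (∧-elim {not ((x ≡ᵇ 0) ∧ (y ≡ᵇ 0))} t)

noDoubleZero-∷suc : ∀ x y r → T (noDoubleZero (suc y ∷ r)) → T (noDoubleZero (x ∷ suc y ∷ r))
noDoubleZero-∷suc x y [] _ = tt
noDoubleZero-∷suc x y (z ∷ r) t = ∧-intro (notF (x ≡ᵇ 0)) t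
  where
  notF : ∀ b → T (not (b ∧ false))
  notF true = tt
  notF false = tt

noDoubleZero-suc∷ : ∀ y x r → T (noDoubleZero (x ∷ r)) → T (noDoubleZero (suc y ∷ x ∷ r))
noDoubleZero-suc∷ y x [] _ = tt
noDoubleZero-suc∷ y x (z ∷ r) t = t

plainUnits-noDoubleZero : ∀ ps tl → (∀ z → T (noDoubleZero (suc z ∷ tl))) →
  ∀ z → T (noDoubleZero (suc z ∷ plainUnits ps tl))
plainUnits-noDoubleZero [] tl h z = h z
plainUnits-noDoubleZero ((d , e) ∷ ps) tl h z =
  noDoubleZero-∷suc (suc z) d (0 ∷ suc e ∷ plainUnits ps tl)
    (noDoubleZero-∷suc 0 e (plainUnits ps tl) (plainUnits-noDoubleZero ps tl h e))

plainUnits-noDoubleZero′ : ∀ q ps tl → (∀ z → T (noDoubleZero (suc z ∷ tl))) →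
  ∀ x → T (noDoubleZero (x ∷ plainUnits (q ∷ ps) tl))
plainUnits-noDoubleZero′ (d , e) ps tl h x =
  noDoubleZero-∷suc x d (0 ∷ suc e ∷ plainUnits ps tl)
    (noDoubleZero-tail 1 (suc d ∷ 0 ∷ suc e ∷ plainUnits ps tl) (plainUnits-noDoubleZero ((d , e) ∷ ps) tl h 0))

unitsWithTwoAt-noDoubleZero : ∀ p ps tl → (∀ x → T (noDoubleZero (x ∷ tl))) →
  ∀ z → T (noDoubleZero (suc z ∷ unitsWithTwoAt p ps tl))
unitsWithTwoAt-noDoubleZero p [] tl h z = h (suc z)
unitsWithTwoAt-noDoubleZero zero ((d , e) ∷ []) [] h z =
  noDoubleZero-suc∷ z d (2 ∷ suc e ∷ []) (noDoubleZero-∷suc d 1 (suc e ∷ []) tt)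
unitsWithTwoAt-noDoubleZero zero ((d , e) ∷ []) (t ∷ tl) h z =
  noDoubleZero-suc∷ z d (2 ∷ e ∷ t ∷ tl) (noDoubleZero-∷suc d 1 (e ∷ t ∷ tl) (noDoubleZero-suc∷ 1 e (t ∷ tl) (h e)))
unitsWithTwoAt-noDoubleZero zero ((d , e) ∷ (q ∷ ps)) tl h z =
  noDoubleZero-suc∷ z d (2 ∷ e ∷ rest) (noDoubleZero-∷suc d 1 (e ∷ rest) (noDoubleZero-suc∷ 1 e rest
    (plainUnits-noDoubleZero′ q ps tl (λ z → h (suc z)) e)))
  where
  rest = plainUnits (q ∷ ps) tl
unitsWithTwoAt-noDoubleZero (suc p) ((d , e) ∷ ps) tl h z =
  noDoubleZero-∷suc (suc z) d (0 ∷ suc e ∷ unitsWithTwoAt p ps tl)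
    (noDoubleZero-∷suc 0 e (unitsWithTwoAt p ps tl) (unitsWithTwoAt-noDoubleZero p ps tl h e))

sumSecondsOfFirst countTwoSecondsOfFirst : ℕ → List ℕ → ℕ
sumSecondsOfFirst zero δ = 0
sumSecondsOfFirst (suc k) (x ∷ y ∷ z ∷ r) = y + sumSecondsOfFirst k r
sumSecondsOfFirst (suc k) δ = sumSeconds δ
countTwoSecondsOfFirst zero δ = 0
countTwoSecondsOfFirst (suc k) (x ∷ y ∷ z ∷ r) = isTwo y + countTwoSecondsOfFirst k r
countTwoSecondsOfFirst (suc k) δ = countTwoSeconds δ

dropUnits : ℕ → List ℕ → List ℕ
dropUnits zero δ = δ
dropUnits (suc k) (x ∷ y ∷ z ∷ r) = dropUnits k r
dropUnits (suc k) _ = []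

sumSeconds-split : ∀ k δ → sumSeconds δ ≡ sumSecondsOfFirst k δ + sumSeconds (dropUnits k δ)
sumSeconds-split zero δ = refl
sumSeconds-split (suc k) (x ∷ y ∷ z ∷ r) = trans (cong (λ u → y + u) (sumSeconds-split k r)) (sym (+-assoc y _ _))
sumSeconds-split (suc k) [] = refl
sumSeconds-split (suc k) (x ∷ []) = refl
sumSeconds-split (suc k) (x ∷ y ∷ []) = sym (+-identityʳ y)

countTwoSeconds-split : ∀ k δ → countTwoSeconds δ ≡ countTwoSecondsOfFirst k δ + countTwoSeconds (dropUnits k δ)
countTwoSeconds-split zero δ = refl
countTwoSeconds-split (suc k) (x ∷ y ∷ z ∷ r) =
  trans (cong (λ u → isTwo y + u) (countTwoSeconds-split k r)) (sym (+-assoc (isTwo y) _ _))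
countTwoSeconds-split (suc k) [] = refl
countTwoSeconds-split (suc k) (x ∷ []) = refl
countTwoSeconds-split (suc k) (x ∷ y ∷ []) = sym (+-identityʳ (isTwo y))

isTwo-≤ : ∀ y → 2 * isTwo y ≤ y
isTwo-≤ zero = z≤n
isTwo-≤ (suc zero) = z≤n
isTwo-≤ (suc (suc zero)) = ≤-refl
isTwo-≤ (suc (suc (suc y))) = z≤n

twice-countTwoSecondsOfFirst≤ : ∀ k δ → 2 * countTwoSecondsOfFirst k δ ≤ sumSecondsOfFirst k δ
twice-countTwoSecondsOfFirst≤ zero δ = z≤n
twice-countTwoSecondsOfFirst≤ (suc k) (x ∷ y ∷ z ∷ r) =
  ≤-trans (≤-reflexive (*-distribˡ-+ 2 (isTwo y) (countTwoSecondsOfFirst k r)))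
          (+-mono-≤ (isTwo-≤ y) (twice-countTwoSecondsOfFirst≤ k r))
twice-countTwoSecondsOfFirst≤ (suc k) [] = z≤n
twice-countTwoSecondsOfFirst≤ (suc k) (x ∷ []) = z≤n
twice-countTwoSecondsOfFirst≤ (suc k) (x ∷ y ∷ []) = isTwo-≤ y

length-drop3 : ∀ k t {n} → 3 + n ≡ 3 * suc k + t → n ≡ 3 * k + t
length-drop3 k t e = suc-injective (suc-injective (suc-injective (trans e (sym (3*suc≡suc³ k t)))))

too-short : ∀ k t (δ : List ℕ) → length δ < 3 → length δ ≢ 3 * suc k + t
too-short k t δ lt e = <⇒≱ lt (subst (3 ≤_) (sym (trans e (sym (3*suc≡suc³ k t)))) (s≤s (s≤s (s≤s z≤n))))

length-dropUnits : ∀ k t δ → length δ ≡ 3 * k + t → length (dropUnits k δ) ≡ t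
length-dropUnits zero t δ e = e
length-dropUnits (suc k) t (x ∷ y ∷ z ∷ r) e = length-dropUnits k t r (length-drop3 k t e)
length-dropUnits (suc k) t [] e = ⊥-elim (too-short k t [] (s≤s z≤n) e)
length-dropUnits (suc k) t (x ∷ []) e = ⊥-elim (too-short k t (x ∷ []) (s≤s (s≤s z≤n)) e)
length-dropUnits (suc k) t (x ∷ y ∷ []) e = ⊥-elim (too-short k t (x ∷ y ∷ []) (s≤s (s≤s (s≤s z≤n))) e)

lastPositive-tail : ∀ x r → r ≢ [] → T (lastPositive (x ∷ r)) → T (lastPositive r)
lastPositive-tail x [] r≢[] _ = ⊥-elim (r≢[] refl)
lastPositive-tail x (y ∷ r) _ t = t

dropUnits-lastPositive : ∀ k δ → dropUnits k δ ≢ [] → T (lastPositive δ) → T (lastPositive (dropUnits k δ))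
dropUnits-lastPositive zero δ _ t = t
dropUnits-lastPositive (suc k) (x ∷ y ∷ z ∷ r) ne t = dropUnits-lastPositive k r ne (lastPositive-tail z r r≢[] t)
  where
  r≢[] : r ≢ []
  r≢[] refl = ne (dropUnits-[] k)
    where
    dropUnits-[] : ∀ k → dropUnits k [] ≡ []
    dropUnits-[] zero = refl
    dropUnits-[] (suc k) = refl
dropUnits-lastPositive (suc k) [] ne t = ⊥-elim (ne refl)
dropUnits-lastPositive (suc k) (x ∷ []) ne t = ⊥-elim (ne refl)
dropUnits-lastPositive (suc k) (x ∷ y ∷ []) ne t = ⊥-elim (ne refl)

noDoubleZero-drop3 : ∀ x y z r → T (noDoubleZero (x ∷ y ∷ z ∷ r)) → T (noDoubleZero r)
noDoubleZero-drop3 x y z r t = noDoubleZero-tail z r (noDoubleZero-tail y (z ∷ r) (noDoubleZero-tail x (y ∷ z ∷ r) t))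

lastPositive-drop3 : ∀ x y z r → T (lastPositive (x ∷ y ∷ z ∷ r)) → T (lastPositive r)
lastPositive-drop3 x y z [] t = tt
lastPositive-drop3 x y z (w ∷ r) t = t

suc[x∸1]≡x : ∀ x → x ≢ 0 → suc (x ∸ 1) ≡ x
suc[x∸1]≡x zero x≢0 = ⊥-elim (x≢0 refl)
suc[x∸1]≡x (suc x) _ = refl

middleZero⇒first≢0 : ∀ x z r → T (noDoubleZero (x ∷ 0 ∷ z ∷ r)) → x ≢ 0
middleZero⇒first≢0 .zero z r ndz refl = proj₁ (∧-elim {false} {noDoubleZero (0 ∷ z ∷ r)} ndz)

-- At the end of the list the third entry is δ_N, positive by lastPositive.
middleZero⇒third≢0 : ∀ x z r → T (noDoubleZero (x ∷ 0 ∷ z ∷ r)) → T (lastPositive (x ∷ 0 ∷ z ∷ r)) → z ≢ 0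
middleZero⇒third≢0 x .zero [] _ lp refl = lp
middleZero⇒third≢0 x .zero (w ∷ r) ndz _ refl =
  proj₁ (∧-elim {false} {noDoubleZero (0 ∷ w ∷ r)} (proj₂ (∧-elim {not ((x ≡ᵇ 0) ∧ true)} ndz)))

plainUnit-rebuild : ∀ x z r {r′} → T (noDoubleZero (x ∷ 0 ∷ z ∷ r)) → T (lastPositive (x ∷ 0 ∷ z ∷ r)) → r′ ≡ r →
  _≡_ {A = List ℕ} (suc (x ∸ 1) ∷ 0 ∷ suc (z ∸ 1) ∷ r′) (x ∷ 0 ∷ z ∷ r)
plainUnit-rebuild x z r ndz lp refl =
  cong₂ _∷_ (suc[x∸1]≡x x (middleZero⇒first≢0 x z r ndz))
    (cong (0 ∷_) (cong (_∷ r) (suc[x∸1]≡x z (middleZero⇒third≢0 x z r ndz lp))))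

record Split (build : Pairs → List ℕ → List ℕ) (k : ℕ) (δ : List ℕ) (ps : Pairs) (tl : List ℕ) : Set where
  constructor split
  field
    rebuild : build ps tl ≡ δ
    length-pairs : length ps ≡ k
    tail≡ : tl ≡ dropUnits k δ

SplitsUnits : ℕ → List ℕ → Set
SplitsUnits k δ = let (p , ps , tl) = splitUnits k δ in p < k × Split (unitsWithTwoAt p) k δ ps tl

splitPlainUnits-correct : ∀ k t δ → length δ ≡ 3 * k + t → T (noDoubleZero δ) → T (lastPositive δ) →
  sumSecondsOfFirst k δ ≡ 0 →
  Split plainUnits k δ (proj₁ (splitPlainUnits k δ)) (proj₂ (splitPlainUnits k δ))
splitPlainUnits-correct zero t δ _ _ _ _ = split refl refl refl
splitPlainUnits-correct (suc k) t (x ∷ y ∷ z ∷ r) len ndz lp seconds with m+n≡0⇒m≡0 y seconds | m+n≡0⇒n≡0 y seconds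
... | refl | seconds′ =
  let split rebuild length-pairs tail≡ =
        splitPlainUnits-correct k t r (length-drop3 k t len) (noDoubleZero-drop3 x 0 z r ndz) (lastPositive-drop3 x 0 z r lp) seconds′ in
  split (plainUnit-rebuild x z r ndz lp rebuild) (cong suc length-pairs) tail≡
splitPlainUnits-correct (suc k) t [] len _ _ _ = ⊥-elim (too-short k t [] (s≤s z≤n) len)
splitPlainUnits-correct (suc k) t (x ∷ []) len _ _ _ = ⊥-elim (too-short k t (x ∷ []) (s≤s (s≤s z≤n)) len)
splitPlainUnits-correct (suc k) t (x ∷ y ∷ []) len _ _ _ = ⊥-elim (too-short k t (x ∷ y ∷ []) (s≤s (s≤s (s≤s z≤n))) len)

specialThird-specialThird⁻¹ : ∀ k r z ps tl → length ps ≡ k → tl ≡ dropUnits k r → (k ≡ 0 → r ≡ [] → z ≢ 0) →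
  specialThird ps tl (specialThird⁻¹ k r z) ≡ z
specialThird-specialThird⁻¹ zero [] z [] .[] refl refl z≢0 = suc[x∸1]≡x z (z≢0 refl refl)
specialThird-specialThird⁻¹ zero (w ∷ r) z [] .(w ∷ r) refl refl _ = refl
specialThird-specialThird⁻¹ (suc k) r z (q ∷ ps) tl refl _ _ = refl

splitUnits-correct : ∀ k t δ → length δ ≡ 3 * k + t → T (noDoubleZero δ) → T (lastPositive δ) →
  sumSecondsOfFirst k δ ≡ 2 → countTwoSecondsOfFirst k δ ≡ 1 →
  SplitsUnits k δ
splitUnits-correct zero t δ _ _ _ () _
splitUnits-correct (suc k) t (x ∷ zero ∷ z ∷ r) len ndz lp seconds twos =
  let (p<k , split rebuild length-pairs tail≡) =
        splitUnits-correct k t r (length-drop3 k t len) (noDoubleZero-drop3 x 0 z r ndz) (lastPositive-drop3 x 0 z r lp) seconds twos in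
  s≤s p<k , split (plainUnit-rebuild x z r ndz lp rebuild) (cong suc length-pairs) tail≡
splitUnits-correct (suc k) t (x ∷ suc zero ∷ z ∷ r) len ndz lp seconds twos =
  ⊥-elim (<-irrefl refl (≤-trans (≤-reflexive (cong (2 *_) (sym twos)))
    (≤-trans (twice-countTwoSecondsOfFirst≤ k r) (≤-reflexive (suc-injective seconds)))))
splitUnits-correct (suc k) t (x ∷ suc (suc zero) ∷ z ∷ r) len ndz lp seconds twos =
  s≤s z≤n ,
  split (cong₂ (λ u v → x ∷ 2 ∷ u ∷ v) (specialThird-specialThird⁻¹ k r z ps tl length-pairs tail≡ z≢0) rebuild)
        (cong suc length-pairs) tail≡
  where
  ps = proj₁ (splitPlainUnits k r)
  tl = proj₂ (splitPlainUnits k r)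
  open Split (splitPlainUnits-correct k t r (length-drop3 k t len) (noDoubleZero-drop3 x 2 z r ndz) (lastPositive-drop3 x 2 z r lp)
                                      (suc-injective (suc-injective seconds)))
  z≢0 : k ≡ 0 → r ≡ [] → z ≢ 0
  z≢0 _ refl refl = lp
splitUnits-correct (suc k) t (x ∷ suc (suc (suc y)) ∷ z ∷ r) len ndz lp () twos
splitUnits-correct (suc k) t [] len _ _ _ _ = ⊥-elim (too-short k t [] (s≤s z≤n) len)
splitUnits-correct (suc k) t (x ∷ []) len _ _ _ _ = ⊥-elim (too-short k t (x ∷ []) (s≤s (s≤s z≤n)) len)
splitUnits-correct (suc k) t (x ∷ y ∷ []) len _ _ _ _ = ⊥-elim (too-short k t (x ∷ y ∷ []) (s≤s (s≤s (s≤s z≤n))) len)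

short-tail-seconds : ∀ tl → length tl ≤ 1 → sumSeconds tl ≡ 0 × countTwoSeconds tl ≡ 0
short-tail-seconds [] _ = refl , refl
short-tail-seconds (x ∷ []) _ = refl , refl
short-tail-seconds (x ∷ y ∷ tl) (s≤s ())

cancel-zero : ∀ {s a b c} → s ≡ a + b → s ≡ c → b ≡ 0 → a ≡ c
cancel-zero {a = a} s≡a+b s≡c b≡0 = trans (sym (+-identityʳ a)) (trans (cong (λ u → a + u) (sym b≡0)) (trans (sym s≡a+b) s≡c))

splitUnits-of-shape : ∀ k t δ → t ≤ 1 → Shape (3 * k + t) δ → SplitsUnits k δ
splitUnits-of-shape k t δ t≤1 sh =
  splitUnits-correct k t δ length≡ no-double-zero last-positive
    (cancel-zero (sumSeconds-split k δ) seconds≡2 (proj₁ tail-free))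
    (cancel-zero (countTwoSeconds-split k δ) twos≡1 (proj₂ tail-free))
  where
  open Shape sh
  tail-free = short-tail-seconds (dropUnits k δ) (subst (_≤ 1) (sym (length-dropUnits k t δ length≡)) t≤1)

empty-tail-of-shape : ∀ k δ → Shape (3 * k + 0) δ → dropUnits k δ ≡ []
empty-tail-of-shape k δ sh with dropUnits k δ | length-dropUnits k 0 δ (Shape.length≡ sh)
... | [] | _ = refl

singleton-tail-of-shape : ∀ k δ → Shape (3 * k + 1) δ → Σ ℕ λ a → dropUnits k δ ≡ a ∷ [] × T (1 ≤ᵇ a)
singleton-tail-of-shape k δ sh
  with dropUnits k δ | length-dropUnits k 1 δ (Shape.length≡ sh) | (λ ne → dropUnits-lastPositive k δ ne (Shape.last-positive sh))
... | a ∷ [] | _ | positive = a , refl , positive (λ ())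

-- In a tail (a , b) the entry b = δ_N ≥ 1 is the second entry of the padded last unit;
-- as the second entries sum to 2 and only one of them is 2, b = 2 and the others vanish.
forced-two : ∀ b y g → y + b ≡ 2 → g + isTwo b ≡ 1 → T (1 ≤ᵇ b) → 2 * g ≤ y → b ≡ 2 × y ≡ 0
forced-two (suc zero) y g y+1≡2 g+0≡1 _ 2g≤y =
  ⊥-elim (<-irrefl refl (≤-trans (≤-reflexive (cong (2 *_) (sym (trans (sym (+-identityʳ g)) g+0≡1))))
                                  (≤-trans 2g≤y (≤-reflexive (+-cancelʳ-≡ 1 y 1 y+1≡2)))))
forced-two (suc (suc zero)) y g y+2≡2 _ _ _ = refl , +-cancelʳ-≡ 2 y 0 y+2≡2
forced-two (suc (suc (suc b))) y g y+b≡2 _ _ _ =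
  ⊥-elim (<⇒≱ (s≤s (s≤s (s≤s z≤n))) (≤-trans (m≤n+m (3 + b) y) (≤-reflexive y+b≡2)))

pair-tail-of-shape : ∀ k δ → Shape (3 * k + 2) δ → Σ ℕ λ a → dropUnits k δ ≡ a ∷ 2 ∷ [] × sumSecondsOfFirst k δ ≡ 0
pair-tail-of-shape k δ sh
  with dropUnits k δ | length-dropUnits k 2 δ (Shape.length≡ sh) | (λ ne → dropUnits-lastPositive k δ ne (Shape.last-positive sh))
     | trans (sym (sumSeconds-split k δ)) (Shape.seconds≡2 sh) | trans (sym (countTwoSeconds-split k δ)) (Shape.twos≡1 sh)
... | a ∷ b ∷ [] | _ | positive | seconds | twos
  with forced-two b (sumSecondsOfFirst k δ) (countTwoSecondsOfFirst k δ) seconds twos (positive λ ()) (twice-countTwoSecondsOfFirst≤ k δ)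
... | refl , first≡0 = a , refl , first≡0

twoAt-< : ∀ p ps → p < length ps → twoAt p ps ≡ 1
twoAt-< zero (_ ∷ ps) _ = refl
twoAt-< (suc p) (_ ∷ ps) (s≤s p<) = twoAt-< p ps p<

specialBump-< : ∀ p ps tl → suc p < length ps → specialBump p ps tl ≡ 0
specialBump-< zero (_ ∷ _ ∷ ps) tl _ = refl
specialBump-< zero (_ ∷ []) tl (s≤s ())
specialBump-< (suc p) (_ ∷ ps) tl (s≤s p<) = specialBump-< p ps tl p<

specialBump-last : ∀ p ps → suc p ≡ length ps → specialBump p ps [] ≡ 1
specialBump-last zero (_ ∷ []) refl = refl
specialBump-last (suc p) (_ ∷ ps) e = specialBump-last p ps (suc-injective e)

specialBump-∷ : ∀ p ps t tl → specialBump p ps (t ∷ tl) ≡ 0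
specialBump-∷ p [] t tl = refl
specialBump-∷ zero (_ ∷ []) t tl = refl
specialBump-∷ zero (_ ∷ _ ∷ _) t tl = refl
specialBump-∷ (suc p) (_ ∷ ps) t tl = specialBump-∷ p ps t tl

suc-sumFirsts-unitsWithTwoAt : ∀ {k} p ps tl → length ps ≡ k → p < k →
  suc (sumFirsts (unitsWithTwoAt p ps tl)) ≡ sumD ps + k + sumFirsts tl
suc-sumFirsts-unitsWithTwoAt p ps tl refl p< =
  trans (trans (+-comm 1 _) (cong (λ g → sumFirsts (unitsWithTwoAt p ps tl) + g) (sym (twoAt-< p ps p<))))
        (sumFirsts-unitsWithTwoAt p ps tl)

short-noDoubleZero : ∀ tl → length tl ≤ 1 → ∀ x → T (noDoubleZero (x ∷ tl))
short-noDoubleZero [] _ x = tt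
short-noDoubleZero (y ∷ []) _ x = tt
short-noDoubleZero (y ∷ z ∷ tl) (s≤s ()) x

unitsWithTwoAt-shape : ∀ {k} p ps tl → length ps ≡ k → p < k → length tl ≤ 1 → T (lastPositive tl) →
  Shape (3 * k + length tl) (unitsWithTwoAt p ps tl)
unitsWithTwoAt-shape p ps tl refl p< short lp = record
  { length≡ = length-unitsWithTwoAt p ps tl
  ; last-positive = unitsWithTwoAt-lastPositive p ps tl lp
  ; no-double-zero = noDoubleZero-tail 1 (unitsWithTwoAt p ps tl)
      (unitsWithTwoAt-noDoubleZero p ps tl (short-noDoubleZero tl short) 0)
  ; seconds≡2 = trans (sumSeconds-unitsWithTwoAt p ps tl) (cong₂ (λ g s → 2 * g + s) (twoAt-< p ps p<) (proj₁ tail-free))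
  ; twos≡1 = trans (countTwoSeconds-unitsWithTwoAt p ps tl) (cong₂ _+_ (twoAt-< p ps p<) (proj₂ tail-free))
  }
  where
  tail-free = short-tail-seconds tl short

plainUnits-shape : ∀ {k} ps a → length ps ≡ k → Shape (3 * k + 2) (plainUnits ps (a ∷ 2 ∷ []))
plainUnits-shape ps a refl = record
  { length≡ = length-plainUnits ps (a ∷ 2 ∷ [])
  ; last-positive = plainUnits-lastPositive ps (a ∷ 2 ∷ []) tt
  ; no-double-zero = noDoubleZero-tail 1 (plainUnits ps (a ∷ 2 ∷ [])) (plainUnits-noDoubleZero ps (a ∷ 2 ∷ []) (λ _ → tt) 0)
  ; seconds≡2 = sumSeconds-plainUnits ps (a ∷ 2 ∷ [])
  ; twos≡1 = countTwoSeconds-plainUnits ps (a ∷ 2 ∷ [])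
  }

invZQ-model : ∀ r → Model (invZQ r)
invZQ-model = prod<-model (λ i → geomInv 1 (3 * i)) (λ i → geomInv-model 1 (3 * i))

invQ3-model : ∀ r → Model (invQ3 r)
invQ3-model = prod<-model (λ i → geomInv 0 (3 * i + 2)) (λ i → geomInv-model 0 (3 * i + 2))

Factors : ℕ → Set
Factors r = Model.Obj (invZQ-model r) × Model.Obj (invQ3-model r)

-- The exponents (dᵢ , eᵢ) of the factors 1/(1 − z q^(3i+1)) and 1/(1 − q^(3i+3)), i < r.
pairsOf : ∀ r → Factors r → Pairs
pairsOf zero _ = []
pairsOf (suc r) ((zs , d) , (qs , e)) = pairsOf r (zs , qs) ∷ʳ (d , e)

-- Lists shorter than r are padded with zero pairs (junk, never used on a shape).
factorsOfReversed : ∀ r → Pairs → Factors r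
factorsOfReversed zero _ = (Fin.zero , Fin.zero)
factorsOfReversed (suc r) [] = let (zs , qs) = factorsOfReversed r [] in ((zs , 0) , (qs , 0))
factorsOfReversed (suc r) ((d , e) ∷ ps) = let (zs , qs) = factorsOfReversed r ps in ((zs , d) , (qs , e))

factorsOf : ∀ r → Pairs → Factors r
factorsOf r ps = factorsOfReversed r (reverse ps)

Fin1-unique : (x : Fin 1) → Fin.zero ≡ x
Fin1-unique Fin.zero = refl

length-pairsOf : ∀ r zq → length (pairsOf r zq) ≡ r
length-pairsOf zero _ = refl
length-pairsOf (suc r) ((zs , d) , (qs , e)) =
  trans (length-++ (pairsOf r (zs , qs))) (trans (cong (_+ 1) (length-pairsOf r (zs , qs))) (+-comm r 1))

factorsOf-pairsOf : ∀ r zq → factorsOf r (pairsOf r zq) ≡ zq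
factorsOf-pairsOf zero (zs , qs) = cong₂ _,_ (Fin1-unique zs) (Fin1-unique qs)
factorsOf-pairsOf (suc r) ((zs , d) , (qs , e))
  rewrite reverse-++ (pairsOf r (zs , qs)) ((d , e) ∷ []) | factorsOf-pairsOf r (zs , qs) = refl

pairsOf-factorsOf : ∀ r ps → length ps ≡ r → pairsOf r (factorsOf r ps) ≡ ps
pairsOf-factorsOf r ps len = trans (reversed r (reverse ps) (trans (length-reverse ps) len)) (reverse-involutive ps)
  where
  reversed : ∀ r ps → length ps ≡ r → pairsOf r (factorsOfReversed r ps) ≡ reverse ps
  reversed zero [] refl = refl
  reversed (suc r) ((d , e) ∷ ps) refl = trans (cong (_∷ʳ (d , e)) (reversed r ps refl)) (sym (unfold-reverse (d , e) ps))

sumD-∷ʳ : ∀ ps d e → sumD (ps ∷ʳ (d , e)) ≡ sumD ps + d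
sumD-∷ʳ [] d e = +-identityʳ d
sumD-∷ʳ ((d′ , e′) ∷ ps) d e rewrite sumD-∷ʳ ps d e = sym (+-assoc d′ _ d)

sumE-∷ʳ : ∀ ps d e → sumE (ps ∷ʳ (d , e)) ≡ sumE ps + e
sumE-∷ʳ [] d e = +-identityʳ e
sumE-∷ʳ ((d′ , e′) ∷ ps) d e rewrite sumE-∷ʳ ps d e = sym (+-assoc e′ _ e)

weightD-∷ʳ : ∀ ps d e → weightD (ps ∷ʳ (d , e)) ≡ weightD ps + d * suc (3 * length ps)
weightD-∷ʳ [] d e = trans (+-identityʳ (d + 0)) (trans (+-identityʳ d) (sym (*-identityʳ d)))
weightD-∷ʳ ((d′ , e′) ∷ ps) d e rewrite sumD-∷ʳ ps d e | weightD-∷ʳ ps d e = arith d′ (sumD ps) (weightD ps) d (length ps)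
  where
  arith : ∀ d′ a w d k → d′ + 3 * (a + d) + (w + d * suc (3 * k)) ≡ d′ + 3 * a + w + d * suc (3 * suc k)
  arith = solve-∀

weightE-∷ʳ : ∀ ps d e → weightE (ps ∷ʳ (d , e)) ≡ weightE ps + e * suc (3 * length ps + 2)
weightE-∷ʳ [] d e = arith e
  where
  arith : ∀ e → 3 * e + 3 * 0 + 0 ≡ 0 + e * suc (3 * 0 + 2)
  arith = solve-∀
weightE-∷ʳ ((d′ , e′) ∷ ps) d e rewrite sumE-∷ʳ ps d e | weightE-∷ʳ ps d e = arith e′ (sumE ps) (weightE ps) e (length ps)
  where
  arith : ∀ e′ a w e k → 3 * e′ + 3 * (a + e) + (w + e * suc (3 * k + 2)) ≡ 3 * e′ + 3 * a + w + e * suc (3 * suc k + 2)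
  arith = solve-∀

weight-invZQ : ∀ r zq → Model.weight (invZQ-model r) (proj₁ zq) ≡ (sumD (pairsOf r zq) , weightD (pairsOf r zq))
weight-invZQ zero zq = refl
weight-invZQ (suc r) ((zs , d) , (qs , e))
  rewrite sumD-∷ʳ (pairsOf r (zs , qs)) d e | weightD-∷ʳ (pairsOf r (zs , qs)) d e
        | length-pairsOf r (zs , qs) | weight-invZQ r (zs , qs) | *-identityˡ d = refl

weight-invQ3 : ∀ r zq → Model.weight (invQ3-model r) (proj₂ zq) ≡ (0 , weightE (pairsOf r zq))
weight-invQ3 zero zq = refl
weight-invQ3 (suc r) ((zs , d) , (qs , e))
  rewrite weightE-∷ʳ (pairsOf r (zs , qs)) d e | length-pairsOf r (zs , qs) | weight-invQ3 r (zs , qs) = refl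

F-model : ∀ n → Model (F n)
F-model n = ⊛-model (mono-model 1 (suc n) (3 * n ^ 2 + 7 * n + 4)) (⊛-model (invZQ-model (suc n)) (invQ3-model (suc n)))

weight-F : ∀ n f zs qs → let ps = pairsOf (suc n) (zs , qs) in
  Model.weight (F-model n) (f , (zs , qs)) ≡ (suc n + (sumD ps + 0) , 3 * n ^ 2 + 7 * n + 4 + (weightD ps + weightE ps))
weight-F n f zs qs =
  cong₂ (λ a b → (suc n + (proj₁ a + proj₁ b) , 3 * n ^ 2 + 7 * n + 4 + (proj₂ a + proj₂ b)))
    (weight-invZQ (suc n) (zs , qs)) (weight-invQ3 (suc n) (zs , qs))

-- G n has one geometric factor 1/(1 − z q^(3n+1)) more in z than in q³; its exponent a is
-- the first difference of the tail.
G-model : ∀ n → Model (G n)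
G-model n = ⊛-model (mono-model 1 (suc n) (3 * n ^ 2 + 4 * n + 1)) (⊛-model (invZQ-model (suc n)) (invQ3-model n))

weight-G : ∀ n f zs a qs → let ps = pairsOf n (zs , qs) in
  Model.weight (G-model n) (f , ((zs , a) , qs)) ≡
    (suc n + ((sumD ps + 1 * a) + 0) , 3 * n ^ 2 + 4 * n + 1 + ((weightD ps + a * suc (3 * n)) + weightE ps))
weight-G n f zs a qs =
  cong₂ (λ u v → (suc n + ((proj₁ u + 1 * a) + proj₁ v) , 3 * n ^ 2 + 4 * n + 1 + ((proj₂ u + a * suc (3 * n)) + proj₂ v)))
    (weight-invZQ n (zs , qs)) (weight-invQ3 n (zs , qs))

module Length3n+3 (n : ℕ) where

  model : Model ((F n ⊛ mono (+ n) 0 0) ⊕ (F n ⊛ mono (+ 1) 0 (3 * n + 3)))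
  model = ⊕-model (⊛-model (F-model n) (mono-model n 0 0)) (⊛-model (F-model n) (mono-model 1 0 (3 * n + 3)))

  open Model model using (Obj; weight)

  -- The factor n of the first summand picks the special unit among the first n units;
  -- in the second summand it is the last unit.
  specialIndex : Obj → ℕ
  specialIndex (inj₁ (_ , i)) = toℕ i
  specialIndex (inj₂ _) = n

  factors : Obj → Factors (suc n)
  factors (inj₁ ((_ , zq) , _)) = zq
  factors (inj₂ ((_ , zq) , _)) = zq

  pairs : Obj → Pairs
  pairs x = pairsOf (suc n) (factors x)

  toDiffs : Obj → List ℕ
  toDiffs x = unitsWithTwoAt (specialIndex x) (pairs x) []

  specialIndex<1+n : ∀ x → specialIndex x < suc n
  specialIndex<1+n (inj₁ (_ , i)) = m≤n⇒m≤1+n (toℕ<n i)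
  specialIndex<1+n (inj₂ _) = ≤-refl

  pairs-length : ∀ x → length (pairs x) ≡ suc n
  pairs-length x = length-pairsOf (suc n) (factors x)

  3[1+n]+0≡3n+3 : 3 * suc n + 0 ≡ 3 * n + 3
  3[1+n]+0≡3n+3 = arith n
    where
    arith : ∀ n → 3 * suc n + 0 ≡ 3 * n + 3
    arith = solve-∀

  toDiffs-shape : ∀ x → Shape (3 * n + 3) (toDiffs x)
  toDiffs-shape x = subst (λ N → Shape N (toDiffs x)) 3[1+n]+0≡3n+3
    (unitsWithTwoAt-shape (specialIndex x) (pairs x) [] (pairs-length x) (specialIndex<1+n x) z≤n tt)

  weight≡ : ∀ x → weight x ≡
    (suc n + (sumD (pairs x) + 0) + 0 ,
     3 * n ^ 2 + 7 * n + 4 + (weightD (pairs x) + weightE (pairs x)) + 3 * suc n * specialBump (specialIndex x) (pairs x) [])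
  weight≡ (inj₁ ((f , (zs , qs)) , i)) =
    trans (cong (λ w → (proj₁ w + 0 , proj₂ w + 0)) (weight-F n f zs qs))
          (cong (λ b → (suc n + (sumD ps + 0) + 0 , 3 * n ^ 2 + 7 * n + 4 + (weightD ps + weightE ps) + b)) (sym no-bump))
    where
    ps = pairsOf (suc n) (zs , qs)
    no-bump : 3 * suc n * specialBump (toℕ i) ps [] ≡ 0
    no-bump = trans (cong (3 * suc n *_) (specialBump-< (toℕ i) ps []
                      (subst (suc (toℕ i) <_) (sym (length-pairsOf (suc n) (zs , qs))) (s≤s (toℕ<n i)))))
                    (*-zeroʳ (3 * suc n))
  weight≡ (inj₂ ((f , (zs , qs)) , _)) =
    trans (cong (λ w → (proj₁ w + 0 , proj₂ w + (3 * n + 3))) (weight-F n f zs qs))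
          (cong (λ b → (suc n + (sumD ps + 0) + 0 , 3 * n ^ 2 + 7 * n + 4 + (weightD ps + weightE ps) + b)) (sym last-bump))
    where
    ps = pairsOf (suc n) (zs , qs)
    last-bump : 3 * suc n * specialBump n ps [] ≡ 3 * n + 3
    last-bump = trans (cong (3 * suc n *_) (specialBump-last n ps (sym (length-pairsOf (suc n) (zs , qs))))) (arith n)
      where
      arith : ∀ n → 3 * suc n * 1 ≡ 3 * n + 3
      arith = solve-∀

  weight-toDiffs : ∀ x → weight x ≡ (suc (sumFirsts (toDiffs x)) , weightedSum (toDiffs x))
  weight-toDiffs x = trans (weight≡ x) (cong₂ _,_ firsts weighted)
    where
    ps = pairs x
    b = specialBump (specialIndex x) ps []
    firsts : suc n + (sumD ps + 0) + 0 ≡ suc (sumFirsts (toDiffs x))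
    firsts = trans (arith n (sumD ps))
      (sym (suc-sumFirsts-unitsWithTwoAt (specialIndex x) ps [] (pairs-length x) (specialIndex<1+n x)))
      where
      arith : ∀ n s → suc n + (s + 0) + 0 ≡ s + suc n + 0
      arith = solve-∀
    weighted : 3 * n ^ 2 + 7 * n + 4 + (weightD ps + weightE ps) + 3 * suc n * b ≡ weightedSum (toDiffs x)
    weighted = trans (arith n (weightD ps) (weightE ps) b)
      (sym (weightedSum-unitsWithTwoAt (specialIndex x) ps [] (pairs-length x)))
      where
      arith : ∀ n u v b → 3 * (n * (n * 1)) + 7 * n + 4 + (u + v) + 3 * suc n * b
                          ≡ u + v + (3 * suc n * suc n + suc n) + 3 * suc n * b + 3 * suc n * 0 + 0
      arith = solve-∀

  fromSplit : (p : ℕ) → Dec (p < n) → Pairs → Obj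
  fromSplit p (yes p<n) ps = inj₁ ((Fin.zero , factorsOf (suc n) ps) , fromℕ< p<n)
  fromSplit p (no _) ps = inj₂ ((Fin.zero , factorsOf (suc n) ps) , Fin.zero)

  fromDiffs : List ℕ → Obj
  fromDiffs δ = let (p , ps , _) = splitUnits (suc n) δ in fromSplit p (p <? n) ps

  fromSplit-toDiffs : ∀ x → fromSplit (specialIndex x) (specialIndex x <? n) (pairs x) ≡ x
  fromSplit-toDiffs (inj₁ ((f , zq) , i)) with toℕ i <? n
  ... | yes i<n = cong₂ (λ a b → inj₁ (a , b)) (cong₂ _,_ (Fin1-unique f) (factorsOf-pairsOf (suc n) zq)) (fromℕ<-toℕ i i<n)
  ... | no i≮n = ⊥-elim (i≮n (toℕ<n i))
  fromSplit-toDiffs (inj₂ ((f , zq) , j)) with n <? n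
  ... | yes n<n = ⊥-elim (<-irrefl refl n<n)
  ... | no _ = cong₂ (λ a b → inj₂ (a , b)) (cong₂ _,_ (Fin1-unique f) (factorsOf-pairsOf (suc n) zq)) (Fin1-unique j)

  fromDiffs-toDiffs : ∀ x → fromDiffs (toDiffs x) ≡ x
  fromDiffs-toDiffs x =
    trans (cong (λ s → fromSplit (proj₁ s) (proj₁ s <? n) (proj₁ (proj₂ s)))
                (splitUnits-unitsWithTwoAt (specialIndex x) (pairs x) [] (pairs-length x) (<⇒≤ (specialIndex<1+n x))))
          (fromSplit-toDiffs x)

  toDiffs-fromSplit : ∀ p ps → p < suc n → length ps ≡ suc n → toDiffs (fromSplit p (p <? n) ps) ≡ unitsWithTwoAt p ps []
  toDiffs-fromSplit p ps p<1+n len with p <? n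
  ... | yes p<n = cong₂ (λ q qs → unitsWithTwoAt q qs []) (toℕ-fromℕ< p<n) (pairsOf-factorsOf (suc n) ps len)
  ... | no p≮n with m≤n⇒m<n∨m≡n (≤-pred p<1+n)
  ...   | inj₁ p<n = ⊥-elim (p≮n p<n)
  ...   | inj₂ refl = cong (λ qs → unitsWithTwoAt p qs []) (pairsOf-factorsOf (suc n) ps len)

  toDiffs-fromDiffs : ∀ δ → Shape (3 * n + 3) δ → toDiffs (fromDiffs δ) ≡ δ
  toDiffs-fromDiffs δ sh =
    trans (toDiffs-fromSplit p ps p<1+n length-pairs)
          (trans (cong (unitsWithTwoAt p ps) (sym (trans tail≡ (empty-tail-of-shape (suc n) δ sh′)))) rebuild)
    where
    sh′ : Shape (3 * suc n + 0) δ
    sh′ = subst (λ N → Shape N δ) (sym 3[1+n]+0≡3n+3) sh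
    p = proj₁ (splitUnits (suc n) δ)
    ps = proj₁ (proj₂ (splitUnits (suc n) δ))
    p<1+n = proj₁ (splitUnits-of-shape (suc n) 0 δ z≤n sh′)
    open Split (proj₂ (splitUnits-of-shape (suc n) 0 δ z≤n sh′))

  encoding : DiffEncoding (3 * n + 3) ((F n ⊛ mono (+ n) 0 0) ⊕ (F n ⊛ mono (+ 1) 0 (3 * n + 3)))
  encoding = record
    { model = model ; toDiffs = toDiffs ; toDiffs-shape = toDiffs-shape ; weight-toDiffs = weight-toDiffs
    ; fromDiffs = fromDiffs ; fromDiffs-toDiffs = fromDiffs-toDiffs ; toDiffs-fromDiffs = toDiffs-fromDiffs }

module Length3n+2 (n : ℕ) where

  model : Model (G n ⊛ mono (+ 1) 0 (3 * n + 3))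
  model = ⊛-model (G-model n) (mono-model 1 0 (3 * n + 3))

  open Model model using (Obj; weight)

  -- No special unit: the tail is (a , 2), with a the exponent of the extra z-factor of G n.
  toDiffs : Obj → List ℕ
  toDiffs ((_ , ((zs , a) , qs)) , _) = plainUnits (pairsOf n (zs , qs)) (a ∷ 2 ∷ [])

  toDiffs-shape : ∀ x → Shape (3 * n + 2) (toDiffs x)
  toDiffs-shape ((_ , ((zs , a) , qs)) , _) = plainUnits-shape (pairsOf n (zs , qs)) a (length-pairsOf n (zs , qs))

  weight-toDiffs : ∀ x → weight x ≡ (suc (sumFirsts (toDiffs x)) , weightedSum (toDiffs x))
  weight-toDiffs ((f , ((zs , a) , qs)) , _) =
    trans (cong (λ w → (proj₁ w + 0 , proj₂ w + (3 * n + 3))) (weight-G n f zs a qs)) (cong₂ _,_ firsts weighted)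
    where
    ps = pairsOf n (zs , qs)
    len = length-pairsOf n (zs , qs)
    firsts : suc n + ((sumD ps + 1 * a) + 0) + 0 ≡ suc (sumFirsts (plainUnits ps (a ∷ 2 ∷ [])))
    firsts = trans (arith n (sumD ps) a) (cong suc (sym (sumFirsts-plainUnits ps (a ∷ 2 ∷ []) len)))
      where
      arith : ∀ n s a → suc n + ((s + 1 * a) + 0) + 0 ≡ suc (s + n + a)
      arith = solve-∀
    weighted : 3 * n ^ 2 + 4 * n + 1 + ((weightD ps + a * suc (3 * n)) + weightE ps) + (3 * n + 3)
               ≡ weightedSum (plainUnits ps (a ∷ 2 ∷ []))
    weighted = trans (arith n (weightD ps) (weightE ps) a) (sym (weightedSum-plainUnits ps (a ∷ 2 ∷ []) len))
      where
      arith : ∀ n u v a → 3 * (n * (n * 1)) + 4 * n + 1 + ((u + a * suc (3 * n)) + v) + (3 * n + 3)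
                          ≡ u + v + (3 * n * n + n) + 3 * n * (a + (2 + 0)) + (a + (2 + 0) + (2 + 0 + 0))
      arith = solve-∀

  fromFactors : Factors n → ℕ → Obj
  fromFactors (zs , qs) a = ((Fin.zero , ((zs , a) , qs)) , Fin.zero)

  fromDiffs : List ℕ → Obj
  fromDiffs δ = let (ps , tl) = splitPlainUnits n δ in fromFactors (factorsOf n ps) (head₀ tl)

  fromDiffs-toDiffs : ∀ x → fromDiffs (toDiffs x) ≡ x
  fromDiffs-toDiffs ((f , ((zs , a) , qs)) , j) =
    trans (cong (λ s → fromFactors (factorsOf n (proj₁ s)) (head₀ (proj₂ s)))
                (splitPlainUnits-plainUnits (pairsOf n (zs , qs)) (a ∷ 2 ∷ []) (length-pairsOf n (zs , qs))))
    (trans (cong (λ zq → fromFactors zq a) (factorsOf-pairsOf n (zs , qs)))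
           (cong₂ (λ f′ j′ → ((f′ , ((zs , a) , qs)) , j′)) (Fin1-unique f) (Fin1-unique j)))

  toDiffs-fromDiffs : ∀ δ → Shape (3 * n + 2) δ → toDiffs (fromDiffs δ) ≡ δ
  toDiffs-fromDiffs δ sh with pair-tail-of-shape n δ sh
  ... | a , tail≡a2 , first≡0 =
    trans (cong₂ plainUnits (pairsOf-factorsOf n ps length-pairs)
                            (trans (cong (λ t → head₀ t ∷ 2 ∷ []) tl≡) (sym tl≡)))
          rebuild
    where
    ps = proj₁ (splitPlainUnits n δ)
    tl = proj₂ (splitPlainUnits n δ)
    open Shape sh
    open Split (splitPlainUnits-correct n 2 δ length≡ no-double-zero last-positive first≡0)
    tl≡ : tl ≡ a ∷ 2 ∷ []
    tl≡ = trans tail≡ tail≡a2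

  encoding : DiffEncoding (3 * n + 2) (G n ⊛ mono (+ 1) 0 (3 * n + 3))
  encoding = record
    { model = model ; toDiffs = toDiffs ; toDiffs-shape = toDiffs-shape ; weight-toDiffs = weight-toDiffs
    ; fromDiffs = fromDiffs ; fromDiffs-toDiffs = fromDiffs-toDiffs ; toDiffs-fromDiffs = toDiffs-fromDiffs }

module Length3n+1 (n : ℕ) (n≥1 : n ≥ 1) where

  model : Model (G n ⊛ mono (+ n) 0 0)
  model = ⊛-model (G-model n) (mono-model n 0 0)

  open Model model using (Obj; weight)

  -- The tail is the single difference δ_N = a + 1 ≥ 1; the factor n picks the special unit.
  toDiffs : Obj → List ℕ
  toDiffs ((_ , ((zs , a) , qs)) , i) = unitsWithTwoAt (toℕ i) (pairsOf n (zs , qs)) (suc a ∷ [])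

  toDiffs-shape : ∀ x → Shape (3 * n + 1) (toDiffs x)
  toDiffs-shape ((_ , ((zs , a) , qs)) , i) =
    unitsWithTwoAt-shape (toℕ i) (pairsOf n (zs , qs)) (suc a ∷ []) (length-pairsOf n (zs , qs)) (toℕ<n i) (s≤s z≤n) tt

  weight-toDiffs : ∀ x → weight x ≡ (suc (sumFirsts (toDiffs x)) , weightedSum (toDiffs x))
  weight-toDiffs ((f , ((zs , a) , qs)) , i) =
    trans (cong (λ w → (proj₁ w + 0 , proj₂ w + 0)) (weight-G n f zs a qs)) (cong₂ _,_ firsts weighted)
    where
    ps = pairsOf n (zs , qs)
    len = length-pairsOf n (zs , qs)
    δ = unitsWithTwoAt (toℕ i) ps (suc a ∷ [])
    firsts : suc n + ((sumD ps + 1 * a) + 0) + 0 ≡ suc (sumFirsts δ)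
    firsts = trans (arith n (sumD ps) a) (sym (suc-sumFirsts-unitsWithTwoAt (toℕ i) ps (suc a ∷ []) len (toℕ<n i)))
      where
      arith : ∀ n s a → suc n + ((s + 1 * a) + 0) + 0 ≡ s + n + suc a
      arith = solve-∀
    weighted : 3 * n ^ 2 + 4 * n + 1 + ((weightD ps + a * suc (3 * n)) + weightE ps) + 0 ≡ weightedSum δ
    weighted = trans (arith n (weightD ps) (weightE ps) a)
      (sym (trans (weightedSum-unitsWithTwoAt (toℕ i) ps (suc a ∷ []) len)
                  (cong (λ b → weightD ps + weightE ps + (3 * n * n + n) + 3 * n * b + 3 * n * (suc a + 0) + (suc a + 0 + 0))
                        (specialBump-∷ (toℕ i) ps (suc a) []))))
      where
      arith : ∀ n u v a → 3 * (n * (n * 1)) + 4 * n + 1 + ((u + a * suc (3 * n)) + v) + 0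
                          ≡ u + v + (3 * n * n + n) + 3 * n * 0 + 3 * n * (suc a + 0) + (suc a + 0 + 0)
      arith = solve-∀

  -- Off the shapes the index is irrelevant; n ≥ 1 supplies a value.
  index : (p : ℕ) → Dec (p < n) → Fin n
  index p (yes p<n) = fromℕ< p<n
  index p (no _) = fromℕ< n≥1

  index-toℕ : ∀ i → index (toℕ i) (toℕ i <? n) ≡ i
  index-toℕ i with toℕ i <? n
  ... | yes i<n = fromℕ<-toℕ i i<n
  ... | no i≮n = ⊥-elim (i≮n (toℕ<n i))

  toℕ-index : ∀ p → p < n → toℕ (index p (p <? n)) ≡ p
  toℕ-index p p<n with p <? n
  ... | yes p<n′ = toℕ-fromℕ< p<n′
  ... | no p≮n = ⊥-elim (p≮n p<n)

  fromFactors : Factors n → ℕ → Fin n → Obj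
  fromFactors (zs , qs) a i = ((Fin.zero , ((zs , a) , qs)) , i)

  fromDiffs : List ℕ → Obj
  fromDiffs δ = let (p , ps , tl) = splitUnits n δ in fromFactors (factorsOf n ps) (head₀ tl ∸ 1) (index p (p <? n))

  fromDiffs-toDiffs : ∀ x → fromDiffs (toDiffs x) ≡ x
  fromDiffs-toDiffs ((f , ((zs , a) , qs)) , i) =
    trans (cong (λ s → let (p , ps , tl) = s in fromFactors (factorsOf n ps) (head₀ tl ∸ 1) (index p (p <? n)))
                (splitUnits-unitsWithTwoAt (toℕ i) (pairsOf n (zs , qs)) (suc a ∷ []) (length-pairsOf n (zs , qs)) (<⇒≤ (toℕ<n i))))
    (trans (cong₂ (λ zq j → fromFactors zq a j) (factorsOf-pairsOf n (zs , qs)) (index-toℕ i))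
           (cong (λ f′ → ((f′ , ((zs , a) , qs)) , i)) (Fin1-unique f)))

  toDiffs-fromDiffs : ∀ δ → Shape (3 * n + 1) δ → toDiffs (fromDiffs δ) ≡ δ
  toDiffs-fromDiffs δ sh with singleton-tail-of-shape n δ sh
  ... | a , tail≡a , a≥1 =
    trans (cong₃ (toℕ-index p p<n) (pairsOf-factorsOf n ps length-pairs)
                 (trans (cong (λ t → suc (head₀ t ∸ 1) ∷ []) tl≡) (trans (cong (_∷ []) (suc[x∸1]≡x a a≢0)) (sym tl≡))))
          rebuild
    where
    p = proj₁ (splitUnits n δ)
    ps = proj₁ (proj₂ (splitUnits n δ))
    tl = proj₂ (proj₂ (splitUnits n δ))
    p<n = proj₁ (splitUnits-of-shape n 1 δ ≤-refl sh)
    open Split (proj₂ (splitUnits-of-shape n 1 δ ≤-refl sh))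
    tl≡ : tl ≡ a ∷ []
    tl≡ = trans tail≡ tail≡a
    a≢0 : a ≢ 0
    a≢0 refl = a≥1
    cong₃ : ∀ {p′ ps′ tl′} → p′ ≡ p → ps′ ≡ ps → tl′ ≡ tl →
      unitsWithTwoAt p′ ps′ tl′ ≡ unitsWithTwoAt p ps tl
    cong₃ refl refl refl = refl

  encoding : DiffEncoding (3 * n + 1) (G n ⊛ mono (+ n) 0 0)
  encoding = record
    { model = model ; toDiffs = toDiffs ; toDiffs-shape = toDiffs-shape ; weight-toDiffs = weight-toDiffs
    ; fromDiffs = fromDiffs ; fromDiffs-toDiffs = fromDiffs-toDiffs ; toDiffs-fromDiffs = toDiffs-fromDiffs }

lemma3p7 : ((n : ℕ) → B (3 * n + 3) ≈ (divZ (F n ⊛ mono (+ n) 0 0) ⊕ divZ (F n ⊛ mono (+ 1) 0 (3 * n + 3))))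
    × ((n : ℕ) → B (3 * n + 2) ≈ divZ (G n ⊛ mono (+ 1) 0 (3 * n + 3)))
    × ((n : ℕ) → n ≥ 1 → B (3 * n + 1) ≈ divZ (G n ⊛ mono (+ n) 0 0))
lemma3p7 =
  (λ n → B≈divZ (Length3n+3.encoding n)) ,
  (λ n → B≈divZ (Length3n+2.encoding n)) ,
  (λ n n≥1 → B≈divZ (Length3n+1.encoding n n≥1))
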